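{- For $|z|<1$ and formal variables $u,v,w$, $$\Phi_0^{\star}(u,v,w;z)=\frac{z}{1-u-v+uv-w}\,{}_3F_2\left({\frac{1-u}{2},\frac{1}{2},1\atop \alpha^{\star},\beta^{\star}};z^2\right),$$ where $\alpha^\star+\beta^\star=3-\frac u2-\frac v2$ and $\alpha^\star\beta^\star=\frac14(9-3u-3v+uv-w)$.
   Context: An index $\mathbf{k}=(k_1,\ldots,k_n)$ of positive integers has weight $k_1+\cdots+k_n$, depth $n$, height $|\{j:k_j\ge2\}|$, and is admissible if $k_1>1$. For an index, $\mathcal{L}^\star_{\mathbf{k}}(z)=\sum_{m_1\ge\cdots\ge m_n>0,\ m_i\text{ odd}}\frac{z^{m_1}}{m_1^{k_1}\cdots m_n^{k_n}}$ for $|z|<1$. $I_0(k,n,s)$ is the set of admissible indices of weight $k$, depth $n$, height $s$, and $G_0^\star(k,n,s;z)=\sum_{\mathbf{k}\in I_0(k,n,s)}\mathcal{L}^\star_{\mathbf{k}}(z)$. $\Phi_0^\star(u,v,w;z)=\sum_{k\ge n+s,\ n\ge s\ge1}G_0^\star(k,n,s;z)u^{k-n-s}v^{n-s}w^{s-1}$. ${}_3F_2\left({a_1,a_2,a_3\atop b_1,b_2};x\right)=\sum_{n\ge0}\frac{(a_1)_n(a_2)_n(a_3)_n}{n!(b_1)_n(b_2)_n}x^n$ with $(a)_0=1$, $(a)_n=a(a+1)\cdots(a+n-1)$; the right-hand side is symmetric in $\alpha^\star,\beta^\star$. -}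

module Defs where

open import Data.Bool using (Bool; true; false; if_then_else_; _∧_)
open import Data.Nat as ℕ using (ℕ; zero; suc; _∸_; _≤ᵇ_; _≡ᵇ_; _%_; _/_)
open import Data.List using (List; []; _∷_; map; concat; length; upTo; zipWith; foldr)
open import Data.Integer using (+_)
open import Data.Rational using (ℚ; 0ℚ; 1ℚ; _+_; _*_; _-_; 1/_; ≢-nonZero)
import Data.Rational as Q
open import Data.Rational.Properties using (_≟_)
open import Relation.Nullary using (yes; no)

ℕ→ℚ : ℕ → ℚ
ℕ→ℚ n = (+ n) Q./ 1

-- reciprocal, with the (never used here) convention 1/0 = 0
recip : ℚ → ℚ
recip q with q ≟ 0ℚ
... | yes _ = 0ℚ
... | no q≢0 = 1/_ q {{≢-nonZero q≢0}}

½ : ℚ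
½ = (+ 1) Q./ 2

¼ : ℚ
¼ = (+ 1) Q./ 4

Σ< : ℕ → (ℕ → ℚ) → ℚ
Σ< zero    f = 0ℚ
Σ< (suc n) f = Σ< n f + f n

Σ≤ : ℕ → (ℕ → ℚ) → ℚ
Σ≤ n f = Σ< (suc n) f

sumL : List ℚ → ℚ
sumL = foldr _+_ 0ℚ

prodL : List ℚ → ℚ
prodL = foldr _*_ 1ℚ

pochℚ : ℚ → ℕ → ℚ
pochℚ q zero    = 1ℚ
pochℚ q (suc n) = pochℚ q n * (q + ℕ→ℚ n)

fact : ℕ → ℕ
fact zero    = 1
fact (suc n) = suc n ℕ.* fact n

-- Formal power series in u, v, w over ℚ:  F a b c = coefficient of u^a v^b w^c

Ser : Set
Ser = ℕ → ℕ → ℕ → ℚ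

δ0 : ℕ → ℕ → ℕ → ℚ
δ0 zero zero zero = 1ℚ
δ0 _    _    _    = 0ℚ

cst : ℚ → Ser
cst q a b c = q * δ0 a b c

U V W : Ser
U a b c = δ0 (a ∸ 1) b c * (if 1 ≤ᵇ a then 1ℚ else 0ℚ)
V a b c = δ0 a (b ∸ 1) c * (if 1 ≤ᵇ b then 1ℚ else 0ℚ)
W a b c = δ0 a b (c ∸ 1) * (if 1 ≤ᵇ c then 1ℚ else 0ℚ)

_⊕_ _⊖_ _⊛_ : Ser → Ser → Ser
(F ⊕ G) a b c = F a b c + G a b c
(F ⊖ G) a b c = F a b c - G a b c
(F ⊛ G) a b c = Σ≤ a λ i → Σ≤ b λ j → Σ≤ c λ k → F i j k * G (a ∸ i) (b ∸ j) (c ∸ k)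

infixl 6 _⊕_ _⊖_
infixl 7 _⊛_

_^ₛ_ : Ser → ℕ → Ser
F ^ₛ zero  = cst 1ℚ
F ^ₛ suc t = (F ^ₛ t) ⊛ F

-- 1/(1 - X) for X with zero constant term (only powers X^t, t ≤ a+b+c, contribute)
geom : Ser → Ser
geom X a b c = Σ≤ (a ℕ.+ b ℕ.+ c) λ t → (X ^ₛ t) a b c

-- multiplicative inverse of a series with nonzero constant term F(0,0,0)
invₛ : Ser → Ser
invₛ F = cst (recip c0) ⊛ geom (cst 1ℚ ⊖ (cst (recip c0) ⊛ F))
  where c0 = F 0 0 0

pochₛ : Ser → ℕ → Ser
pochₛ F zero    = cst 1ℚ
pochₛ F (suc n) = pochₛ F n ⊛ (F ⊕ cst (ℕ→ℚ n))

comps : ℕ → ℕ → List (List ℕ)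
comps zero    zero    = [] ∷ []
comps (suc k) zero    = []
comps k       (suc n) = concat (map (λ p → map (suc p ∷_) (comps (k ∸ suc p) n)) (upTo k))

height : List ℕ → ℕ
height []       = 0
height (x ∷ xs) = (if 2 ≤ᵇ x then 1 else 0) ℕ.+ height xs

admissible : List ℕ → Bool
admissible []      = false
admissible (x ∷ _) = 2 ≤ᵇ x

-- I₀(k,n,s): admissible indices of weight k, depth n, height s
I₀ : ℕ → ℕ → ℕ → List (List ℕ)
I₀ k n s = filt (comps k n)
  where
  filt : List (List ℕ) → List (List ℕ)
  filt [] = []
  filt (x ∷ xs) = if admissible x ∧ (height x ≡ᵇ s) then x ∷ filt xs else filt xs

odd : ℕ → Bool
odd m = m % 2 ≡ᵇ 1

downSeqs : ℕ → ℕ → List (List ℕ)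
downSeqs b zero    = [] ∷ []
downSeqs b (suc n) =
  concat (map (λ p → if odd (suc p) then map (suc p ∷_) (downSeqs (suc p) n) else []) (upTo b))

term : List ℕ → List ℕ → ℚ
term ms ks = prodL (zipWith (λ m k → recip (ℕ→ℚ (m ℕ.^ k))) ms ks)

-- coefficient of z^m in 𝓛⋆_𝐤(z): sum over m = m₁ ≥ ⋯ ≥ mₙ > 0 all odd
Lcoef : List ℕ → ℕ → ℚ
Lcoef []       m = 0ℚ
Lcoef (k ∷ ks) m =
  if odd m then sumL (map (λ rest → term (m ∷ rest) (k ∷ ks)) (downSeqs m (length ks))) else 0ℚ

Gcoef : ℕ → ℕ → ℕ → ℕ → ℚ
Gcoef k n s m = sumL (map (λ ks → Lcoef ks m) (I₀ k n s))

-- coefficient of z^m u^a v^b w^c in Φ₀⋆(u,v,w;z):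
-- a = k-n-s, b = n-s, c = s-1, i.e. s = c+1, n = b+s, k = a+n+s
Φcoef : ℕ → ℕ → ℕ → ℕ → ℚ
Φcoef m a b c = Gcoef (a ℕ.+ n ℕ.+ s) n s m
  where
  s = suc c
  n = b ℕ.+ s

-- e₁ = α⋆+β⋆ = 3 - u/2 - v/2 ,  e₂ = α⋆β⋆ = (9 - 3u - 3v + uv - w)/4
e₁ e₂ : Ser
e₁ = cst (ℕ→ℚ 3) ⊖ cst ½ ⊛ U ⊖ cst ½ ⊛ V
e₂ = cst ¼ ⊛ (cst (ℕ→ℚ 9) ⊖ cst (ℕ→ℚ 3) ⊛ U ⊖ cst (ℕ→ℚ 3) ⊛ V ⊕ U ⊛ V ⊖ W)

-- (α⋆)_n (β⋆)_n = ∏_{j<n} (α⋆+j)(β⋆+j) = ∏_{j<n} (e₂ + j e₁ + j²)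
pochαβ : ℕ → Ser
pochαβ zero    = cst 1ℚ
pochαβ (suc n) = pochαβ n ⊛ (e₂ ⊕ cst (ℕ→ℚ n) ⊛ e₁ ⊕ cst (ℕ→ℚ (n ℕ.* n)))

-- n-th term of ₃F₂((1-u)/2, 1/2, 1 ; α⋆, β⋆ ; x), as a series in u,v,w
F32term : ℕ → Ser
F32term n = pochₛ (cst ½ ⊖ cst ½ ⊛ U) n
            ⊛ cst (pochℚ ½ n * pochℚ 1ℚ n * recip (ℕ→ℚ (fact n)))
            ⊛ invₛ (pochαβ n)

D : Ser
D = cst 1ℚ ⊖ U ⊖ V ⊕ U ⊛ V ⊖ W

-- coefficient of z^m u^a v^b w^c in  z/(1-u-v+uv-w) · ₃F₂(… ; z²)
RHScoef : ℕ → ℕ → ℕ → ℕ → ℚ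
RHScoef m a b c = if odd m then (invₛ D ⊛ F32term (m / 2)) a b c else 0ℚ

{-# OPTIONS --safe #-}
-- Write t⋆ x 𝐤 for the sum of the coefficients of z, …, z^x in 𝓛⋆_𝐤, T x for the generating function
-- Σ_𝐤 t⋆ x 𝐤 u^{k−n−s} v^{n−s} w^s over all indices, and Φ m for the coefficient of z^m in Φ₀⋆
-- (zero for even m). Splitting an index after its first entry gives, for odd m,
--   Φ m · (m² − mu) = T m   and   T m − T (m − 1) = v · T m / m + w · Φ m,
-- while T does not change at even steps. Hence T m · N m = T (m − 2) · M m for M q = q² − qu and
-- N q = q² − qu − (q − u)v − w, and so
--   Φ (2n+1) · M (2n+1) · ∏_{j≤n} N (2j+1) = ∏_{j≤n} M (2j+1).
-- Since M (2j+1) = 4((1−u)/2 + j)(1/2 + j), N 1 = 1 − u − v + uv − w and N (2j+3) = 4(α⋆ + j)(β⋆ + j),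
-- the z^(2n+1)-coefficient of the right-hand side satisfies the same identity, and the products
-- cancel because their constant terms are nonzero.

module Submission where

open import Algebra.Bundles using (CommutativeRing)
open import Data.Nat using (ℕ)
open import Relation.Binary.PropositionalEquality using (_≡_)
open import Defs

module PowerSeries {c ℓ} (R : CommutativeRing c ℓ) where

  open import Algebra.Structures using (IsCommutativeRing)
  import Algebra.Construct.Pointwise as Pointwise
  open import Data.Fin.Base as Fin using (Fin; toℕ; opposite)
  open import Data.Fin.Properties using (toℕ≤pred[n]; opposite-prop)
  open import Data.Fin.Permutation using (reverse)
  open import Data.Nat.Base using (ℕ; zero; suc; _∸_)
  open import Data.Nat.Properties using (m∸[m∸n]≡n)
  open import Data.Product.Base using (_,_)
  open import Data.Vec.Functional using (Vector)
  open import Function.Base using (_∘_)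
  import Relation.Binary.PropositionalEquality as ≡

  open CommutativeRing R hiding (zero)
  import Algebra.Properties.Semiring.Sum
  open import Algebra.Properties.Semiring.Sum semiring
  open import Relation.Binary.Reasoning.Setoid setoid

  Series : Set c
  Series = ℕ → Carrier

  infix 4 _≋_
  _≋_ : Series → Series → Set ℓ
  f ≋ g = ∀ n → f n ≈ g n

  infixl 6 _⊞_
  infixl 7 _⊠_

  _⊞_ : Series → Series → Series
  (f ⊞ g) n = f n + g n

  ⊟_ : Series → Series
  (⊟ f) n = - f n

  𝟘 : Series
  𝟘 n = 0#

  infixr 8 _·_
  _·_ : Carrier → Series → Series
  (x · f) n = x * f n

  const : Carrier → Series
  const x zero    = x
  const x (suc n) = 0#

  X : Series
  X zero          = 0#
  X (suc zero)    = 1#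
  X (suc (suc n)) = 0#

  _⊠_ : Series → Series → Series
  (f ⊠ g) n = ∑[ i ≤ n ] (f (toℕ i) * g (n ∸ toℕ i))

  ⊠-cong : ∀ {f f′ g g′} → f ≋ f′ → g ≋ g′ → f ⊠ g ≋ f′ ⊠ g′
  ⊠-cong f≋f′ g≋g′ n = sum-cong-≋ {suc n} λ i → *-cong (f≋f′ (toℕ i)) (g≋g′ (n ∸ toℕ i))

  ⊠-zero : ∀ f g → (f ⊠ g) 0 ≈ f 0 * g 0
  ⊠-zero f g = +-identityʳ (f 0 * g 0)

  ⊠-suc : ∀ f g → (f ⊠ g) ∘ suc ≋ f 0 · (g ∘ suc) ⊞ (f ∘ suc) ⊠ g
  ⊠-suc f g n = refl

  ⊠-distribˡ : ∀ f g h → f ⊠ (g ⊞ h) ≋ f ⊠ g ⊞ f ⊠ h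
  ⊠-distribˡ f g h n = begin
    ∑[ i ≤ n ] (f (toℕ i) * (g (n ∸ toℕ i) + h (n ∸ toℕ i)))
      ≈⟨ sum-cong-≋ {suc n} (λ i → distribˡ (f (toℕ i)) (g (n ∸ toℕ i)) (h (n ∸ toℕ i))) ⟩
    ∑[ i ≤ n ] (f (toℕ i) * g (n ∸ toℕ i) + f (toℕ i) * h (n ∸ toℕ i))
      ≈⟨ ∑-distrib-+ {suc n} (λ i → f (toℕ i) * g (n ∸ toℕ i)) (λ i → f (toℕ i) * h (n ∸ toℕ i)) ⟩
    (f ⊠ g ⊞ f ⊠ h) n ∎

  ⊠-distribʳ : ∀ f g h → (g ⊞ h) ⊠ f ≋ g ⊠ f ⊞ h ⊠ f
  ⊠-distribʳ f g h n = begin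
    ∑[ i ≤ n ] ((g (toℕ i) + h (toℕ i)) * f (n ∸ toℕ i))
      ≈⟨ sum-cong-≋ {suc n} (λ i → distribʳ (f (n ∸ toℕ i)) (g (toℕ i)) (h (toℕ i))) ⟩
    ∑[ i ≤ n ] (g (toℕ i) * f (n ∸ toℕ i) + h (toℕ i) * f (n ∸ toℕ i))
      ≈⟨ ∑-distrib-+ {suc n} (λ i → g (toℕ i) * f (n ∸ toℕ i)) (λ i → h (toℕ i) * f (n ∸ toℕ i)) ⟩
    (g ⊠ f ⊞ h ⊠ f) n ∎

  const-⊠ : ∀ x f → const x ⊠ f ≋ x · f
  const-⊠ x f zero    = ⊠-zero (const x) f
  const-⊠ x f (suc n) = begin
    x * f (suc n) + ∑[ i ≤ n ] (0# * f (n ∸ toℕ i)) ≈⟨ +-congˡ (sum-cong-≋ {suc n} λ i → zeroˡ (f (n ∸ toℕ i))) ⟩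
    x * f (suc n) + ∑[ i ≤ n ] 0#                   ≈⟨ +-congˡ (sum-replicate-zero (suc n)) ⟩
    x * f (suc n) + 0#                              ≈⟨ +-identityʳ _ ⟩
    x * f (suc n)                                   ∎

  ⊠-comm : ∀ f g → f ⊠ g ≋ g ⊠ f
  ⊠-comm f g n = begin
    ∑[ i ≤ n ] (f (toℕ i) * g (n ∸ toℕ i))
      ≈⟨ ∑-permute (λ i → f (toℕ i) * g (n ∸ toℕ i)) (reverse {suc n}) ⟩
    ∑[ i ≤ n ] (f (toℕ (opposite i)) * g (n ∸ toℕ (opposite i)))
      ≈⟨ sum-cong-≋ {suc n} reflect ⟩
    ∑[ i ≤ n ] (g (toℕ i) * f (n ∸ toℕ i))
      ∎
    where
    reflect : ∀ (i : Fin (suc n)) →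
              f (toℕ (opposite i)) * g (n ∸ toℕ (opposite i)) ≈ g (toℕ i) * f (n ∸ toℕ i)
    reflect i rewrite opposite-prop {suc n} i | m∸[m∸n]≡n (toℕ≤pred[n] i) = *-comm _ _

  ·-⊠ : ∀ x f g → (x · f) ⊠ g ≋ x · (f ⊠ g)
  ·-⊠ x f g n = begin
    ∑[ i ≤ n ] ((x * f (toℕ i)) * g (n ∸ toℕ i))
      ≈⟨ sum-cong-≋ {suc n} (λ i → *-assoc x (f (toℕ i)) (g (n ∸ toℕ i))) ⟩
    ∑[ i ≤ n ] (x * (f (toℕ i) * g (n ∸ toℕ i)))
      ≈⟨ *-distribˡ-sum {suc n} x (λ i → f (toℕ i) * g (n ∸ toℕ i)) ⟨
    x * (f ⊠ g) n
      ∎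

  ⊠-assoc : ∀ f g h → (f ⊠ g) ⊠ h ≋ f ⊠ (g ⊠ h)
  ⊠-assoc f g h zero = begin
    ((f ⊠ g) ⊠ h) 0    ≈⟨ ⊠-zero (f ⊠ g) h ⟩
    (f ⊠ g) 0 * h 0    ≈⟨ *-congʳ (⊠-zero f g) ⟩
    (f 0 * g 0) * h 0  ≈⟨ *-assoc (f 0) (g 0) (h 0) ⟩
    f 0 * (g 0 * h 0)  ≈⟨ *-congˡ (⊠-zero g h) ⟨
    f 0 * (g ⊠ h) 0    ≈⟨ ⊠-zero f (g ⊠ h) ⟨
    (f ⊠ (g ⊠ h)) 0    ∎
  ⊠-assoc f g h (suc n) = begin
    (f ⊠ g) 0 * h (suc n) + ((f ⊠ g) ∘ suc ⊠ h) n
      ≈⟨ +-cong (*-congʳ (⊠-zero f g)) (⊠-cong {g = h} {h} (⊠-suc f g) (λ _ → refl) n) ⟩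
    (f 0 * g 0) * h (suc n) + ((f 0 · (g ∘ suc) ⊞ f ∘ suc ⊠ g) ⊠ h) n
      ≈⟨ +-cong (*-assoc (f 0) (g 0) (h (suc n))) (⊠-distribʳ h (f 0 · (g ∘ suc)) (f ∘ suc ⊠ g) n) ⟩
    f 0 * (g 0 * h (suc n)) + ((f 0 · (g ∘ suc) ⊠ h) n + ((f ∘ suc ⊠ g) ⊠ h) n)
      ≈⟨ +-congˡ (+-cong (·-⊠ (f 0) (g ∘ suc) h n) (⊠-assoc (f ∘ suc) g h n)) ⟩
    f 0 * (g 0 * h (suc n)) + (f 0 * (g ∘ suc ⊠ h) n + (f ∘ suc ⊠ (g ⊠ h)) n)
      ≈⟨ +-assoc _ _ _ ⟨
    (f 0 * (g 0 * h (suc n)) + f 0 * (g ∘ suc ⊠ h) n) + (f ∘ suc ⊠ (g ⊠ h)) n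
      ≈⟨ +-congʳ (distribˡ (f 0) _ _) ⟨
    f 0 * (g ⊠ h) (suc n) + (f ∘ suc ⊠ (g ⊠ h)) n
      ∎

  𝟙 : Series
  𝟙 = const 1#

  ⊠-identityˡ : ∀ f → 𝟙 ⊠ f ≋ f
  ⊠-identityˡ f n = trans (const-⊠ 1# f n) (*-identityˡ (f n))

  ⊠-isCommutativeRing : IsCommutativeRing _≋_ _⊞_ _⊠_ ⊟_ 𝟘 𝟙
  ⊠-isCommutativeRing = record
    { isRing = record
      { +-isAbelianGroup = Pointwise.isAbelianGroup ℕ +-isAbelianGroup
      ; *-cong = ⊠-cong
      ; *-assoc = ⊠-assoc
      ; *-identity = ⊠-identityˡ , λ f n → trans (⊠-comm f 𝟙 n) (⊠-identityˡ f n)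
      ; distrib = ⊠-distribˡ , ⊠-distribʳ
      }
    ; *-comm = ⊠-comm
    }

  seriesRing : CommutativeRing c ℓ
  seriesRing = record { isCommutativeRing = ⊠-isCommutativeRing }

  const-cong : ∀ {x y} → x ≈ y → const x ≋ const y
  const-cong x≈y zero    = x≈y
  const-cong x≈y (suc n) = refl

  const-* : ∀ x y → const x ⊠ const y ≋ const (x * y)
  const-* x y zero    = const-⊠ x (const y) zero
  const-* x y (suc n) = trans (const-⊠ x (const y) (suc n)) (zeroʳ x)

  ⊠X-zero : ∀ f → (f ⊠ X) 0 ≈ 0#
  ⊠X-zero f = trans (⊠-zero f X) (zeroʳ (f 0))

  ⊠X-suc : ∀ f n → (f ⊠ X) (suc n) ≈ f n
  ⊠X-suc f n = begin
    (f ⊠ X) (suc n)                        ≈⟨ ⊠-comm f X (suc n) ⟩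
    0# * f (suc n) + (X ∘ suc ⊠ f) n       ≈⟨ +-cong (zeroˡ _) (⊠-cong {g = f} {g′ = f} X∘suc≋𝟙 (λ _ → refl) n) ⟩
    0# + (𝟙 ⊠ f) n                         ≈⟨ +-identityˡ _ ⟩
    (𝟙 ⊠ f) n                              ≈⟨ ⊠-identityˡ f n ⟩
    f n                                    ∎
    where
    X∘suc≋𝟙 : X ∘ suc ≋ 𝟙
    X∘suc≋𝟙 zero    = refl
    X∘suc≋𝟙 (suc n) = refl

  ⊠-const : ∀ f x → f ⊠ const x ≋ x · f
  ⊠-const f x n = trans (⊠-comm f (const x) n) (const-⊠ x f n)

  sumₛ : ∀ {n} → Vector Series n → Series
  sumₛ = Algebra.Properties.Semiring.Sum.sum (CommutativeRing.semiring seriesRing)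

  sum-apply : ∀ {n} (fs : Vector Series n) m → sumₛ fs m ≡.≡ sum (λ i → fs i m)
  sum-apply {zero}  fs m = ≡.refl
  sum-apply {suc n} fs m = ≡.cong (fs Fin.zero m +_) (sum-apply (fs ∘ Fin.suc) m)

module PrefixSums where

  open import Algebra.Bundles using (CommutativeRing)
  open import Defs using (Σ<)
  open import Data.Fin.Base using (toℕ)
  open import Data.Fin.Properties using (toℕ-inject₁; toℕ-fromℕ)
  open import Data.Nat.Base using (zero; suc; _<_)
  open import Data.Nat.Properties using (m<n⇒m<1+n; n<1+n)
  open import Data.Rational.Base using (0ℚ; _+_; _*_)
  open import Data.Rational.Properties using (+-*-commutativeRing; *-zeroʳ; *-distribˡ-+)
  open import Data.Vec.Functional using (init; last)
  open import Function.Base using (_∘_)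
  open import Relation.Binary.PropositionalEquality
  open import Algebra.Properties.Semiring.Sum (CommutativeRing.semiring +-*-commutativeRing)
  open ≡-Reasoning

  Σ<≡∑ : ∀ n f → Σ< n f ≡ ∑[ i < n ] f (toℕ i)
  Σ<≡∑ zero    f = refl
  Σ<≡∑ (suc n) f = begin
    Σ< n f + f n                                      ≡⟨ cong (_+ f n) (Σ<≡∑ n f) ⟩
    ∑[ i < n ] f (toℕ i) + f n                        ≡⟨ cong₂ _+_ (sum-cong-≗ {n} (cong f ∘ toℕ-inject₁))
                                                                   (cong f (toℕ-fromℕ n)) ⟨
    sum {n} (init (f ∘ toℕ)) + last {n = n} (f ∘ toℕ) ≡⟨ sum-init-last {n} (f ∘ toℕ) ⟨
    ∑[ i < suc n ] f (toℕ i)                          ∎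

  Σ<-cong : ∀ n {f g} → (∀ i → i < n → f i ≡ g i) → Σ< n f ≡ Σ< n g
  Σ<-cong zero    f≡g = refl
  Σ<-cong (suc n) f≡g = cong₂ _+_ (Σ<-cong n λ i i<n → f≡g i (m<n⇒m<1+n i<n)) (f≡g n (n<1+n n))

  Σ<-zero : ∀ n {f} → (∀ i → i < n → f i ≡ 0ℚ) → Σ< n f ≡ 0ℚ
  Σ<-zero zero    f≡0 = refl
  Σ<-zero (suc n) f≡0 = cong₂ _+_ (Σ<-zero n λ i i<n → f≡0 i (m<n⇒m<1+n i<n)) (f≡0 n (n<1+n n))

  Σ<-*ˡ : ∀ n q f → Σ< n (λ i → q * f i) ≡ q * Σ< n f
  Σ<-*ˡ zero    q f = sym (*-zeroʳ q)
  Σ<-*ˡ (suc n) q f = trans (cong (_+ q * f n) (Σ<-*ˡ n q f)) (sym (*-distribˡ-+ q (Σ< n f) (f n)))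

  Σ<-first : ∀ n f → Σ< (suc n) f ≡ f 0 + Σ< n (f ∘ suc)
  Σ<-first n f = trans (Σ<≡∑ (suc n) f) (cong (f 0 +_) (sym (Σ<≡∑ n (f ∘ suc))))

module RationalFacts where

  open import Algebra.Bundles using (CommutativeRing)
  open import Data.Empty using (⊥-elim)
  open import Data.Integer.Base as ℤ using (+_)
  import Data.Integer.Properties as ℤ
  open import Data.Nat.Base as ℕ using (ℕ; zero; suc; NonZero)
  import Data.Nat.Properties as ℕ
  import Data.Nat.Coprimality as Coprime
  open import Data.Rational.Base using (0ℚ; 1ℚ; _+_; _*_; _-_; toℚᵘ; ≢-nonZero)
  open import Data.Rational.Properties
    using (normalize-coprime; toℚᵘ-injective; toℚᵘ-homo-+; toℚᵘ-homo-*; _≟_; *-inverseˡ;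
           *-identityˡ; *-identityʳ; *-assoc; *-zeroʳ; *-comm; +-*-commutativeRing)
  open import Data.Rational.Unnormalised.Base as ℚᵘ using (mkℚᵘ; *≡*)
  import Data.Rational.Unnormalised.Properties as ℚᵘ
  open import Relation.Binary.PropositionalEquality
  open import Relation.Nullary.Decidable using (yes; no)
  open import Defs using (ℕ→ℚ; recip; fact; pochℚ; ½)

  toℚᵘ-ℕ→ℚ : ∀ n → toℚᵘ (ℕ→ℚ n) ≡ mkℚᵘ (+ n) 0
  toℚᵘ-ℕ→ℚ n = cong toℚᵘ (normalize-coprime {n} {0} (Coprime.sym (Coprime.1-coprimeTo n)))

  ℕ→ℚ-+ : ∀ m n → ℕ→ℚ (m ℕ.+ n) ≡ ℕ→ℚ m + ℕ→ℚ n
  ℕ→ℚ-+ m n = toℚᵘ-injective (begin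
    toℚᵘ (ℕ→ℚ (m ℕ.+ n))                       ≡⟨ toℚᵘ-ℕ→ℚ (m ℕ.+ n) ⟩
    mkℚᵘ (+ (m ℕ.+ n)) 0                        ≈⟨ *≡* numerators ⟩
    mkℚᵘ (+ m) 0 ℚᵘ.+ mkℚᵘ (+ n) 0             ≡⟨ cong₂ ℚᵘ._+_ (toℚᵘ-ℕ→ℚ m) (toℚᵘ-ℕ→ℚ n) ⟨
    toℚᵘ (ℕ→ℚ m) ℚᵘ.+ toℚᵘ (ℕ→ℚ n)             ≈⟨ toℚᵘ-homo-+ (ℕ→ℚ m) (ℕ→ℚ n) ⟨
    toℚᵘ (ℕ→ℚ m + ℕ→ℚ n)                       ∎)
    where
    open ℚᵘ.≃-Reasoning
    numerators : + (m ℕ.+ n) ℤ.* + 1 ≡ (+ m ℤ.* + 1 ℤ.+ + n ℤ.* + 1) ℤ.* + 1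
    numerators rewrite ℤ.*-identityʳ (+ m) | ℤ.*-identityʳ (+ n) = cong (ℤ._* + 1) (ℤ.pos-+ m n)

  ℕ→ℚ-* : ∀ m n → ℕ→ℚ (m ℕ.* n) ≡ ℕ→ℚ m * ℕ→ℚ n
  ℕ→ℚ-* m n = toℚᵘ-injective (begin
    toℚᵘ (ℕ→ℚ (m ℕ.* n))                       ≡⟨ toℚᵘ-ℕ→ℚ (m ℕ.* n) ⟩
    mkℚᵘ (+ (m ℕ.* n)) 0                        ≈⟨ *≡* numerators ⟩
    mkℚᵘ (+ m) 0 ℚᵘ.* mkℚᵘ (+ n) 0             ≡⟨ cong₂ ℚᵘ._*_ (toℚᵘ-ℕ→ℚ m) (toℚᵘ-ℕ→ℚ n) ⟨
    toℚᵘ (ℕ→ℚ m) ℚᵘ.* toℚᵘ (ℕ→ℚ n)             ≈⟨ toℚᵘ-homo-* (ℕ→ℚ m) (ℕ→ℚ n) ⟨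
    toℚᵘ (ℕ→ℚ m * ℕ→ℚ n)                       ∎)
    where
    open ℚᵘ.≃-Reasoning
    numerators : + (m ℕ.* n) ℤ.* + 1 ≡ (+ m ℤ.* + n) ℤ.* + 1
    numerators = cong (ℤ._* + 1) (ℤ.pos-* m n)

  ℕ→ℚ-≢0 : ∀ n .{{_ : ℕ.NonZero n}} → ℕ→ℚ n ≢ 0ℚ
  ℕ→ℚ-≢0 (suc n) eq with trans (sym (toℚᵘ-ℕ→ℚ (suc n))) (cong toℚᵘ eq)
  ... | ()

  recip-inverseˡ : ∀ {q} → q ≢ 0ℚ → recip q * q ≡ 1ℚ
  recip-inverseˡ {q} q≢0 with q ≟ 0ℚ
  ... | yes q≡0 = ⊥-elim (q≢0 q≡0)
  ... | no  q≢0 = *-inverseˡ q {{≢-nonZero q≢0}}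

  *-≢0 : ∀ {p q} → p ≢ 0ℚ → q ≢ 0ℚ → p * q ≢ 0ℚ
  *-≢0 {p} {q} p≢0 q≢0 pq≡0 = q≢0 (begin
    q                   ≡⟨ *-identityˡ q ⟨
    1ℚ * q              ≡⟨ cong (_* q) (recip-inverseˡ p≢0) ⟨
    (recip p * p) * q   ≡⟨ *-assoc (recip p) p q ⟩
    recip p * (p * q)   ≡⟨ cong (recip p *_) pq≡0 ⟩
    recip p * 0ℚ        ≡⟨ *-zeroʳ (recip p) ⟩
    0ℚ                  ∎)
    where open ≡-Reasoning

  recip-* : ∀ {p q} → p ≢ 0ℚ → q ≢ 0ℚ → recip (p * q) ≡ recip p * recip q
  recip-* {p} {q} p≢0 q≢0 = begin
    recip (p * q)                              ≡⟨ *-identityʳ _ ⟨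
    recip (p * q) * 1ℚ                         ≡⟨ cong (recip (p * q) *_) r*pq≡1 ⟨
    recip (p * q) * (r * (p * q))              ≡⟨ x∙yz≈y∙xz (recip (p * q)) r (p * q) ⟩
    r * (recip (p * q) * (p * q))              ≡⟨ cong (r *_) (recip-inverseˡ (*-≢0 p≢0 q≢0)) ⟩
    r * 1ℚ                                     ≡⟨ *-identityʳ r ⟩
    r                                          ∎
    where
    open ≡-Reasoning
    open import Algebra.Properties.CommutativeSemigroup
      (CommutativeRing.*-commutativeSemigroup +-*-commutativeRing) using (x∙yz≈y∙xz; interchange)
    r = recip p * recip q
    r*pq≡1 : r * (p * q) ≡ 1ℚ
    r*pq≡1 = trans (interchange (recip p) (recip q) p q)
                   (cong₂ _*_ (recip-inverseˡ p≢0) (recip-inverseˡ q≢0))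

  r²[i²t+iφ]-rφ≡t : ∀ r i t φ → i * r ≡ 1ℚ → (r * r) * ((i * i) * t + i * φ) - r * φ ≡ t
  r²[i²t+iφ]-rφ≡t r i t φ ir≡1 = begin
    (r * r) * ((i * i) * t + i * φ) - r * φ
      ≡⟨ solve 4 (λ r i t φ → (r :* r) :* ((i :* i) :* t :+ i :* φ) :- r :* φ
                              := (i :* r) :* ((i :* r) :* t) :+ (i :* r) :* (r :* φ) :- r :* φ) refl r i t φ ⟩
    (i * r) * ((i * r) * t) + (i * r) * (r * φ) - r * φ
      ≡⟨ cong (λ x → x * (x * t) + x * (r * φ) - r * φ) ir≡1 ⟩
    1ℚ * (1ℚ * t) + 1ℚ * (r * φ) - r * φ
      ≡⟨ solve 2 (λ t x → con 1ℚ :* (con 1ℚ :* t) :+ con 1ℚ :* x :- x := t) refl t (r * φ) ⟩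
    t ∎
    where
    open ≡-Reasoning
    open import Data.Rational.Solver using (module +-*-Solver)
    open +-*-Solver

  fact-nonZero : ∀ n → NonZero (fact n)
  fact-nonZero zero    = _
  fact-nonZero (suc n) = ℕ.m*n≢0 (suc n) (fact n) {{_}} {{fact-nonZero n}}

  poch-1≡fact : ∀ n → pochℚ 1ℚ n ≡ ℕ→ℚ (fact n)
  poch-1≡fact zero    = refl
  poch-1≡fact (suc n) = begin
    pochℚ 1ℚ n * (1ℚ + ℕ→ℚ n)          ≡⟨ cong₂ _*_ (poch-1≡fact n) (sym (ℕ→ℚ-+ 1 n)) ⟩
    ℕ→ℚ (fact n) * ℕ→ℚ (suc n)         ≡⟨ *-comm (ℕ→ℚ (fact n)) (ℕ→ℚ (suc n)) ⟩
    ℕ→ℚ (suc n) * ℕ→ℚ (fact n)         ≡⟨ ℕ→ℚ-* (suc n) (fact n) ⟨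
    ℕ→ℚ (fact (suc n))                 ∎
    where open ≡-Reasoning

  F32-coefficient : ∀ n → pochℚ ½ n * pochℚ 1ℚ n * recip (ℕ→ℚ (fact n)) ≡ pochℚ ½ n
  F32-coefficient n = begin
    pochℚ ½ n * pochℚ 1ℚ n * recip n!         ≡⟨ cong (λ x → pochℚ ½ n * x * recip n!) (poch-1≡fact n) ⟩
    pochℚ ½ n * n! * recip n!                 ≡⟨ *-assoc (pochℚ ½ n) n! (recip n!) ⟩
    pochℚ ½ n * (n! * recip n!)               ≡⟨ cong (pochℚ ½ n *_) (trans (*-comm n! (recip n!)) n!⁻¹n!≡1) ⟩
    pochℚ ½ n * 1ℚ                            ≡⟨ *-identityʳ (pochℚ ½ n) ⟩
    pochℚ ½ n                                 ∎
    where
    open ≡-Reasoning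
    n! = ℕ→ℚ (fact n)
    n!⁻¹n!≡1 : recip n! * n! ≡ 1ℚ
    n!⁻¹n!≡1 = recip-inverseˡ (ℕ→ℚ-≢0 (fact n) {{fact-nonZero n}})

module Parity where

  open import Data.Bool.Base as Bool using (true; false)
  open import Data.Nat.Base as ℕ using (ℕ; suc; _/_; _%_; NonZero)
  import Data.Nat.Properties as ℕ
  open import Data.Nat.DivMod using (m≡m%n+[m/n]*n; [m+kn]%n≡m%n)
  open import Data.Nat.Tactic.RingSolver using (solve-∀)
  open import Relation.Binary.PropositionalEquality
  open import Defs using (odd)

  odd⇒nonZero : ∀ {m} → odd m ≡ true → NonZero m
  odd⇒nonZero {suc m} _ = _

  odd-2n+1 : ∀ n → odd (suc (n ℕ.+ n)) ≡ true
  odd-2n+1 n = cong (ℕ._≡ᵇ 1) (trans (cong (_% 2) (arithmetic n)) ([m+kn]%n≡m%n 1 n 2))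
    where
    arithmetic : ∀ n → suc (n ℕ.+ n) ≡ 1 ℕ.+ n ℕ.* 2
    arithmetic = solve-∀

  odd-2n+2 : ∀ n → odd (suc (suc (n ℕ.+ n))) ≡ false
  odd-2n+2 n = cong (ℕ._≡ᵇ 1) (trans (cong (_% 2) (arithmetic n)) ([m+kn]%n≡m%n 0 (suc n) 2))
    where
    arithmetic : ∀ n → suc (suc (n ℕ.+ n)) ≡ 0 ℕ.+ suc n ℕ.* 2
    arithmetic = solve-∀

  odd⇒≡2n+1 : ∀ {m} → odd m ≡ true → m ≡ suc (m / 2 ℕ.+ m / 2)
  odd⇒≡2n+1 {m} odd-m = begin
    m                           ≡⟨ m≡m%n+[m/n]*n m 2 ⟩
    m % 2 ℕ.+ m / 2 ℕ.* 2       ≡⟨ cong₂ ℕ._+_ m%2≡1 (ℕ.*-comm (m / 2) 2) ⟩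
    1 ℕ.+ 2 ℕ.* (m / 2)         ≡⟨ cong (λ k → suc (m / 2 ℕ.+ k)) (ℕ.+-identityʳ (m / 2)) ⟩
    suc (m / 2 ℕ.+ m / 2)       ∎
    where
    open ≡-Reasoning
    m%2≡1 : m % 2 ≡ 1
    m%2≡1 = ℕ.≡ᵇ⇒≡ (m % 2) 1 (subst Bool.T (sym odd-m) _)

module Trivariate where

  open import Algebra.Bundles using (CommutativeRing)
  open import Algebra.Structures using (IsCommutativeRing)
  open import Data.Fin.Base using (toℕ)
  open import Data.Bool.Base using (if_then_else_)
  open import Data.Nat.Base using (ℕ; zero; suc; _∸_; _≤ᵇ_)
  open import Data.Product.Base using (_,_)
  open import Data.Rational.Base using (ℚ; 0ℚ; 1ℚ; _+_; _*_; -_)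
  open import Data.Rational.Properties as ℚ
    using (+-*-commutativeRing; *-zeroʳ; *-zeroˡ; *-identityʳ; +-identityˡ; *-distribʳ-+; neg-distribˡ-*)
  open import Level using (0ℓ)
  open import Relation.Binary.PropositionalEquality
  open import Defs
  open PrefixSums using (Σ<≡∑)
  open import Function.Base using (_$_)
  open import Algebra.Properties.Semiring.Sum (CommutativeRing.semiring +-*-commutativeRing)

  -- Ser is ℚ[[w]][[v]][[u]]: power series in u over power series in v over ℚ[[w]].
  module S₀ = PowerSeries +-*-commutativeRing
  module S₁ = PowerSeries S₀.seriesRing
  module S₂ = PowerSeries S₁.seriesRing

  infix 4 _≈ₛ_
  _≈ₛ_ : Ser → Ser → Set
  F ≈ₛ G = ∀ a b c → F a b c ≡ G a b c

  ⊛≈⊠ : ∀ F G → F ⊛ G ≈ₛ F S₂.⊠ G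
  ⊛≈⊠ F G a b c = begin
    Σ≤ a (λ i → Σ≤ b λ j → Σ≤ c λ k → F i j k * G (a ∸ i) (b ∸ j) (c ∸ k))
      ≡⟨ Σ<≡∑ (suc a) _ ⟩
    ∑[ i ≤ a ] Σ≤ b (λ j → Σ≤ c λ k → F (toℕ i) j k * G (a ∸ toℕ i) (b ∸ j) (c ∸ k))
      ≡⟨ sum-cong-≗ {suc a} (λ i → trans (Σ<≡∑ (suc b) (λ j → Σ≤ c (t (toℕ i) j)))
                                         (sum-cong-≗ {suc b} λ j → Σ<≡∑ (suc c) (t (toℕ i) (toℕ j)))) ⟩
    ∑[ i ≤ a ] ∑[ j ≤ b ] (F (toℕ i) (toℕ j) S₀.⊠ G (a ∸ toℕ i) (b ∸ toℕ j)) c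
      ≡⟨ sum-cong-≗ {suc a} (λ i →
           S₀.sum-apply {suc b} (λ j → F (toℕ i) (toℕ j) S₀.⊠ G (a ∸ toℕ i) (b ∸ toℕ j)) c) ⟨
    ∑[ i ≤ a ] (F (toℕ i) S₁.⊠ G (a ∸ toℕ i)) b c
      ≡⟨ S₀.sum-apply {suc a} (λ i → (F (toℕ i) S₁.⊠ G (a ∸ toℕ i)) b) c ⟨
    S₀.sumₛ {suc a} (λ i → (F (toℕ i) S₁.⊠ G (a ∸ toℕ i)) b) c
      ≡⟨ cong (_$ c) (S₁.sum-apply {suc a} (λ i → F (toℕ i) S₁.⊠ G (a ∸ toℕ i)) b) ⟨
    (F S₂.⊠ G) a b c ∎
    where
    open ≡-Reasoning
    t : ℕ → ℕ → ℕ → ℚ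
    t i j k = F i j k * G (a ∸ i) (b ∸ j) (c ∸ k)

  const₃ : ℚ → Ser
  const₃ q = S₂.const (S₁.const (S₀.const q))

  δ0≡const₃ : ∀ a b c → δ0 a b c ≡ const₃ 1ℚ a b c
  δ0≡const₃ zero    zero    zero    = refl
  δ0≡const₃ zero    zero    (suc c) = refl
  δ0≡const₃ zero    (suc b) c       = refl
  δ0≡const₃ (suc a) b       c       = refl

  cst≈const₃ : ∀ q → cst q ≈ₛ const₃ q
  cst≈const₃ q zero    zero    zero    = *-identityʳ q
  cst≈const₃ q zero    zero    (suc c) = *-zeroʳ q
  cst≈const₃ q zero    (suc b) c       = *-zeroʳ q
  cst≈const₃ q (suc a) b       c       = *-zeroʳ q

  module 𝕊 = CommutativeRing S₂.seriesRing

  ⊛-isCommutativeRing : IsCommutativeRing _≈ₛ_ _⊕_ _⊛_ S₂.⊟_ S₂.𝟘 (cst 1ℚ)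
  ⊛-isCommutativeRing = record
    { isRing = record
      { +-isAbelianGroup = 𝕊.+-isAbelianGroup
      ; *-cong = λ {F} {F′} {G} {G′} F≈F′ G≈G′ →
          𝕊.trans (⊛≈⊠ F G) (𝕊.trans (𝕊.*-cong F≈F′ G≈G′) (𝕊.sym (⊛≈⊠ F′ G′)))
      ; *-assoc = λ F G H → 𝕊.trans (⊛≈⊠ (F ⊛ G) H) (𝕊.trans (𝕊.*-congʳ {H} (⊛≈⊠ F G))
          (𝕊.trans (𝕊.*-assoc F G H) (𝕊.sym (𝕊.trans (⊛≈⊠ F (G ⊛ H)) (𝕊.*-congˡ {F} (⊛≈⊠ G H))))))
      ; *-identity =
          (λ F → 𝕊.trans (⊛≈⊠ (cst 1ℚ) F) (𝕊.trans (𝕊.*-congʳ {F} (cst≈const₃ 1ℚ)) (𝕊.*-identityˡ F))) ,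
          (λ F → 𝕊.trans (⊛≈⊠ F (cst 1ℚ)) (𝕊.trans (𝕊.*-congˡ {F} (cst≈const₃ 1ℚ)) (𝕊.*-identityʳ F)))
      ; distrib =
          (λ F G H → 𝕊.trans (⊛≈⊠ F (G ⊕ H))
            (𝕊.trans (𝕊.distribˡ F G H) (𝕊.sym (𝕊.+-cong (⊛≈⊠ F G) (⊛≈⊠ F H))))) ,
          (λ F G H → 𝕊.trans (⊛≈⊠ (G ⊕ H) F)
            (𝕊.trans (𝕊.distribʳ F G H) (𝕊.sym (𝕊.+-cong (⊛≈⊠ G F) (⊛≈⊠ H F)))))
      }
    ; *-comm = λ F G → 𝕊.trans (⊛≈⊠ F G) (𝕊.trans (𝕊.*-comm F G) (𝕊.sym (⊛≈⊠ G F)))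
    }

  serRing : CommutativeRing 0ℓ 0ℓ
  serRing = record { isCommutativeRing = ⊛-isCommutativeRing }

  module Ser = CommutativeRing serRing

  cst-+ : ∀ p q → cst (p + q) ≈ₛ cst p ⊕ cst q
  cst-+ p q a b c = *-distribʳ-+ (δ0 a b c) p q

  cst-neg : ∀ p → cst (- p) ≈ₛ S₂.⊟ cst p
  cst-neg p a b c = sym (neg-distribˡ-* p (δ0 a b c))

  cst-0 : cst 0ℚ ≈ₛ S₂.𝟘
  cst-0 a b c = *-zeroˡ (δ0 a b c)

  cst-* : ∀ p q → cst p ⊛ cst q ≈ₛ cst (p * q)
  cst-* p q = begin
    cst p ⊛ cst q               ≈⟨ ⊛≈⊠ (cst p) (cst q) ⟩
    cst p S₂.⊠ cst q            ≈⟨ 𝕊.*-cong (cst≈const₃ p) (cst≈const₃ q) ⟩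
    const₃ p S₂.⊠ const₃ q      ≈⟨ S₂.const-* (S₁.const (S₀.const p)) (S₁.const (S₀.const q)) ⟩
    S₂.const (S₁.const (S₀.const p) S₁.⊠ S₁.const (S₀.const q))
                                ≈⟨ S₂.const-cong (S₁.const-* (S₀.const p) (S₀.const q)) ⟩
    S₂.const (S₁.const (S₀.const p S₀.⊠ S₀.const q))
                                ≈⟨ S₂.const-cong (S₁.const-cong (S₀.const-* p q)) ⟩
    const₃ (p * q)              ≈⟨ Ser.sym (cst≈const₃ (p * q)) ⟩
    cst (p * q)                 ∎
    where open import Relation.Binary.Reasoning.Setoid Ser.setoid

  cst-cong : ∀ {p q} → p ≡ q → cst p ≈ₛ cst q
  cst-cong refl = Ser.refl

  module SerSolver where
    open import Algebra.Solver.Ring.AlmostCommutativeRing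
      using (fromCommutativeRing; _-Raw-AlmostCommutative⟶_)
    open import Data.Maybe.Base using (map)
    open import Relation.Nullary.Decidable using (dec⇒maybe)

    cst-homomorphism : CommutativeRing.rawRing +-*-commutativeRing -Raw-AlmostCommutative⟶ fromCommutativeRing serRing
    cst-homomorphism = record
      { ⟦_⟧    = cst
      ; +-homo = cst-+
      ; *-homo = λ p q → Ser.sym (cst-* p q)
      ; -‿homo = cst-neg
      ; 0-homo = cst-0
      ; 1-homo = Ser.refl
      }

    open import Algebra.Solver.Ring (CommutativeRing.rawRing +-*-commutativeRing)
      (fromCommutativeRing serRing) cst-homomorphism
      (λ p q → map cst-cong (dec⇒maybe (p ℚ.≟ q)))
      public

  shiftU shiftV shiftW : Ser → Ser
  shiftU F zero    b c = 0ℚ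
  shiftU F (suc a) b c = F a b c
  shiftV F a zero    c = 0ℚ
  shiftV F a (suc b) c = F a b c
  shiftW F a b zero    = 0ℚ
  shiftW F a b (suc c) = F a b c

  U≈X : U ≈ₛ S₂.X
  U≈X zero          b c = *-zeroʳ (δ0 0 b c)
  U≈X (suc zero)    b c = trans (*-identityʳ (δ0 0 b c)) (δ0≡const₃ 0 b c)
  U≈X (suc (suc a)) b c = refl

  V≈X : V ≈ₛ S₂.const S₁.X
  V≈X zero    zero          c = *-zeroʳ (δ0 0 0 c)
  V≈X (suc a) zero          c = refl
  V≈X zero    (suc zero)    c = trans (*-identityʳ (δ0 0 0 c)) (δ0≡const₃ 0 0 c)
  V≈X zero    (suc (suc b)) c = refl
  V≈X (suc a) (suc b)       c = refl

  W≈X : W ≈ₛ S₂.const (S₁.const S₀.X)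
  W≈X zero    zero    zero          = refl
  W≈X zero    zero    (suc zero)    = refl
  W≈X zero    zero    (suc (suc c)) = refl
  W≈X zero    (suc b) c             = *-zeroˡ (if 1 ≤ᵇ c then 1ℚ else 0ℚ)
  W≈X (suc a) b       c             = *-zeroˡ (if 1 ≤ᵇ c then 1ℚ else 0ℚ)

  ⊛U : ∀ F → F ⊛ U ≈ₛ shiftU F
  ⊛U F = Ser.trans (⊛≈⊠ F U) (Ser.trans (𝕊.*-congˡ {F} U≈X) shift)
    where
    shift : F S₂.⊠ S₂.X ≈ₛ shiftU F
    shift zero    = S₂.⊠X-zero F
    shift (suc a) = S₂.⊠X-suc F a

  ⊛V : ∀ F → F ⊛ V ≈ₛ shiftV F
  ⊛V F = Ser.trans (⊛≈⊠ F V) (Ser.trans (𝕊.*-congˡ {F} V≈X) shift)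
    where
    shift : F S₂.⊠ S₂.const S₁.X ≈ₛ shiftV F
    shift a b c = trans (S₂.⊠-const F S₁.X a b c) (trans (S₁.⊠-comm S₁.X (F a) b c) (shift₁ b c))
      where
      shift₁ : ∀ b c → (F a S₁.⊠ S₁.X) b c ≡ shiftV F a b c
      shift₁ zero    = S₁.⊠X-zero (F a)
      shift₁ (suc b) = S₁.⊠X-suc (F a) b

  ⊛W : ∀ F → F ⊛ W ≈ₛ shiftW F
  ⊛W F = Ser.trans (⊛≈⊠ F W) (Ser.trans (𝕊.*-congˡ {F} W≈X) shift)
    where
    shift : F S₂.⊠ S₂.const (S₁.const S₀.X) ≈ₛ shiftW F
    shift a b c = begin
      (F S₂.⊠ S₂.const (S₁.const S₀.X)) a b c ≡⟨ S₂.⊠-const F (S₁.const S₀.X) a b c ⟩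
      (S₁.const S₀.X S₁.⊠ F a) b c            ≡⟨ S₁.const-⊠ S₀.X (F a) b c ⟩
      (S₀.X S₀.⊠ F a b) c                     ≡⟨ S₀.⊠-comm S₀.X (F a b) c ⟩
      (F a b S₀.⊠ S₀.X) c                     ≡⟨ shift₀ c ⟩
      shiftW F a b c                          ∎
      where
      open ≡-Reasoning
      shift₀ : ∀ c → (F a b S₀.⊠ S₀.X) c ≡ shiftW F a b c
      shift₀ zero    = S₀.⊠X-zero (F a b)
      shift₀ (suc c) = S₀.⊠X-suc (F a b) c

  cst-scale : ∀ q F → cst q ⊛ F ≈ₛ λ a b c → q * F a b c
  cst-scale q F a b c = begin
    (cst q ⊛ F) a b c                                  ≡⟨ ⊛≈⊠ (cst q) F a b c ⟩
    (cst q S₂.⊠ F) a b c                               ≡⟨ 𝕊.*-congʳ {F} (cst≈const₃ q) a b c ⟩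
    (const₃ q S₂.⊠ F) a b c                            ≡⟨ S₂.const-⊠ (S₁.const (S₀.const q)) F a b c ⟩
    (S₁.const (S₀.const q) S₁.⊠ F a) b c               ≡⟨ S₁.const-⊠ (S₀.const q) (F a) b c ⟩
    (S₀.const q S₀.⊠ F a b) c                          ≡⟨ S₀.const-⊠ q (F a b) c ⟩
    q * F a b c                                        ∎
    where open ≡-Reasoning

  ⊛-origin : ∀ F G → (F ⊛ G) 0 0 0 ≡ F 0 0 0 * G 0 0 0
  ⊛-origin F G = trans (+-identityˡ _) (trans (+-identityˡ _) (+-identityˡ _))

  ⊛-origin-zeroʳ : ∀ F {G} → G 0 0 0 ≡ 0ℚ → (F ⊛ G) 0 0 0 ≡ 0ℚ
  ⊛-origin-zeroʳ F {G} G₀≡0 = trans (⊛-origin F G) (trans (cong (F 0 0 0 *_) G₀≡0) (*-zeroʳ (F 0 0 0)))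

module Inverse where

  open import Data.Nat.Base as ℕ using (ℕ; zero; suc; _∸_; _≤_; _<_; s≤s; s≤s⁻¹)
  open import Data.Nat.Properties as ℕ
    using (_<?_; ≮⇒≥; <⇒≱; +-mono-<-≤; +-mono-≤-<; +-mono-≤; ≤-trans; m≤n⇒m∸n≡0; m≤m+n; n<1+n;
           +-identityʳ; +-suc; m+[n∸m]≡n)
  open import Data.Product.Base using (_×_; _,_)
  open import Data.Rational.Base using (ℚ; 0ℚ; 1ℚ; _+_; _*_; _-_)
  open import Data.Rational.Properties using (*-zeroˡ; *-zeroʳ; *-identityʳ)
  import Data.Rational.Properties as ℚ
  open import Relation.Binary.PropositionalEquality
  open import Relation.Nullary.Decidable using (yes; no)
  open import Relation.Nullary.Negation using (contradiction)
  open import Defs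
  open PrefixSums
  open RationalFacts using (recip-inverseˡ)
  open Trivariate
  open SerSolver using (solve; _:=_; _:+_; _:*_; _:-_; con)

  squeeze₃ : ∀ {i j k a b c} → i ≤ a → j ≤ b → k ≤ c → a ℕ.+ b ℕ.+ c ≤ i ℕ.+ j ℕ.+ k →
            a ≤ i × b ≤ j × c ≤ k
  squeeze₃ {i} {j} {k} {a} {b} {c} i≤a j≤b k≤c abc≤ijk = a≤i , b≤j , c≤k
    where
    a≤i : a ≤ i
    a≤i with i <? a
    ... | yes i<a = contradiction abc≤ijk (<⇒≱ (+-mono-<-≤ (+-mono-<-≤ i<a j≤b) k≤c))
    ... | no  i≮a = ≮⇒≥ i≮a
    b≤j : b ≤ j
    b≤j with j <? b
    ... | yes j<b = contradiction abc≤ijk (<⇒≱ (+-mono-<-≤ (+-mono-≤-< i≤a j<b) k≤c))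
    ... | no  j≮b = ≮⇒≥ j≮b
    c≤k : c ≤ k
    c≤k with k <? c
    ... | yes k<c = contradiction abc≤ijk (<⇒≱ (+-mono-≤-< (+-mono-≤ i≤a j≤b) k<c))
    ... | no  k≮c = ≮⇒≥ k≮c

  -- In a term (X ^ₛ t) i j k * X (a ∸ i) (b ∸ j) (c ∸ k) either i + j + k < t, or
  -- i + j + k ≥ t > a + b + c forces (a ∸ i, b ∸ j, c ∸ k) = (0, 0, 0).
  ^ₛ-vanishes : ∀ X → X 0 0 0 ≡ 0ℚ → ∀ t a b c → a ℕ.+ b ℕ.+ c < t → (X ^ₛ t) a b c ≡ 0ℚ
  ^ₛ-vanishes X X₀≡0 (suc t) a b c abc<1+t =
    Σ<-zero (suc a) λ i i≤a → Σ<-zero (suc b) λ j j≤b → Σ<-zero (suc c) λ k k≤c →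
      term≡0 i j k (s≤s⁻¹ i≤a) (s≤s⁻¹ j≤b) (s≤s⁻¹ k≤c)
    where
    term≡0 : ∀ i j k → i ≤ a → j ≤ b → k ≤ c → (X ^ₛ t) i j k * X (a ∸ i) (b ∸ j) (c ∸ k) ≡ 0ℚ
    term≡0 i j k i≤a j≤b k≤c with i ℕ.+ j ℕ.+ k <? t
    ... | yes ijk<t = trans (cong (_* X (a ∸ i) (b ∸ j) (c ∸ k)) (^ₛ-vanishes X X₀≡0 t i j k ijk<t))
                            (*-zeroˡ (X (a ∸ i) (b ∸ j) (c ∸ k)))
    ... | no  ijk≮t with squeeze₃ i≤a j≤b k≤c (≤-trans (s≤s⁻¹ abc<1+t) (≮⇒≥ ijk≮t))
    ...   | a≤i , b≤j , c≤k rewrite m≤n⇒m∸n≡0 a≤i | m≤n⇒m∸n≡0 b≤j | m≤n⇒m∸n≡0 c≤k =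
      trans (cong ((X ^ₛ t) i j k *_) X₀≡0) (*-zeroʳ ((X ^ₛ t) i j k))

  ⊛-congˡ-below : ∀ {F F′} G a b c → (∀ i j k → i ≤ a → j ≤ b → k ≤ c → F i j k ≡ F′ i j k) →
                  (F ⊛ G) a b c ≡ (F′ ⊛ G) a b c
  ⊛-congˡ-below {F} {F′} G a b c F≡F′ =
    Σ<-cong (suc a) λ i i≤a → Σ<-cong (suc b) λ j j≤b → Σ<-cong (suc c) λ k k≤c →
      cong (_* G (a ∸ i) (b ∸ j) (c ∸ k)) (F≡F′ i j k (s≤s⁻¹ i≤a) (s≤s⁻¹ j≤b) (s≤s⁻¹ k≤c))

  geomₙ : Ser → ℕ → Ser
  geomₙ X n a b c = Σ< n λ t → (X ^ₛ t) a b c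

  module _ (X : Ser) (X₀≡0 : X 0 0 0 ≡ 0ℚ) where

    geomₙ-stable : ∀ k {a b c m} → a ℕ.+ b ℕ.+ c < m → geomₙ X (m ℕ.+ k) a b c ≡ geomₙ X m a b c
    geomₙ-stable zero    {a} {b} {c} {m} abc<m = cong (λ n → geomₙ X n a b c) (+-identityʳ m)
    geomₙ-stable (suc k) {a} {b} {c} {m} abc<m = begin
      geomₙ X (m ℕ.+ suc k) a b c                      ≡⟨ cong (λ n → geomₙ X n a b c) (+-suc m k) ⟩
      geomₙ X (m ℕ.+ k) a b c + (X ^ₛ (m ℕ.+ k)) a b c ≡⟨ cong (geomₙ X (m ℕ.+ k) a b c +_) X^m+k≡0 ⟩
      geomₙ X (m ℕ.+ k) a b c + 0ℚ                     ≡⟨ ℚ.+-identityʳ _ ⟩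
      geomₙ X (m ℕ.+ k) a b c                          ≡⟨ geomₙ-stable k abc<m ⟩
      geomₙ X m a b c                                  ∎
      where
      open ≡-Reasoning
      X^m+k≡0 = ^ₛ-vanishes X X₀≡0 (m ℕ.+ k) a b c (≤-trans abc<m (m≤m+n m k))

    geom≡geomₙ : ∀ {a b c n} → a ℕ.+ b ℕ.+ c < n → geom X a b c ≡ geomₙ X n a b c
    geom≡geomₙ {a} {b} {c} {n} abc<n = sym (begin
      geomₙ X n a b c               ≡⟨ cong (λ n → geomₙ X n a b c) (m+[n∸m]≡n abc<n) ⟨
      geomₙ X (d ℕ.+ (n ∸ d)) a b c ≡⟨ geomₙ-stable (n ∸ d) {a} {b} {c} (n<1+n _) ⟩
      geom X a b c                  ∎)
      where
      open ≡-Reasoning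
      d = suc (a ℕ.+ b ℕ.+ c)

    geomₙ-telescopes : ∀ n → geomₙ X (suc n) ⊛ (cst 1ℚ ⊖ X) ≈ₛ cst 1ℚ ⊖ X ^ₛ suc n
    geomₙ-telescopes zero = begin
      (S₂.𝟘 ⊕ cst 1ℚ) ⊛ (cst 1ℚ ⊖ X) ≈⟨ Ser.*-congʳ {cst 1ℚ ⊖ X} (Ser.+-identityˡ (cst 1ℚ)) ⟩
      cst 1ℚ ⊛ (cst 1ℚ ⊖ X)          ≈⟨ solve 1 (λ x → con 1ℚ :* (con 1ℚ :- x) := con 1ℚ :- con 1ℚ :* x) Ser.refl X ⟩
      cst 1ℚ ⊖ cst 1ℚ ⊛ X            ∎
      where open import Relation.Binary.Reasoning.Setoid Ser.setoid
    geomₙ-telescopes (suc n) = begin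
      (G ⊕ P) ⊛ (cst 1ℚ ⊖ X)
        ≈⟨ solve 3 (λ g p x → (g :+ p) :* (con 1ℚ :- x) := g :* (con 1ℚ :- x) :+ (p :- p :* x)) Ser.refl G P X ⟩
      G ⊛ (cst 1ℚ ⊖ X) ⊕ (P ⊖ P ⊛ X)
        ≈⟨ Ser.+-congʳ (geomₙ-telescopes n) ⟩
      (cst 1ℚ ⊖ P) ⊕ (P ⊖ P ⊛ X)
        ≈⟨ solve 2 (λ p q → (con 1ℚ :- p) :+ (p :- q) := con 1ℚ :- q) Ser.refl P (P ⊛ X) ⟩
      cst 1ℚ ⊖ P ⊛ X
        ∎
      where
      open import Relation.Binary.Reasoning.Setoid Ser.setoid
      G = geomₙ X (suc n)
      P = X ^ₛ suc n

    geom-inverse : geom X ⊛ (cst 1ℚ ⊖ X) ≈ₛ cst 1ℚ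
    geom-inverse a b c = begin
      (geom X ⊛ (cst 1ℚ ⊖ X)) a b c
        ≡⟨ ⊛-congˡ-below (cst 1ℚ ⊖ X) a b c (λ i j k i≤a j≤b k≤c →
             geom≡geomₙ (s≤s (+-mono-≤ (+-mono-≤ i≤a j≤b) k≤c))) ⟩
      (geomₙ X (suc d) ⊛ (cst 1ℚ ⊖ X)) a b c
        ≡⟨ geomₙ-telescopes d a b c ⟩
      cst 1ℚ a b c - (X ^ₛ suc d) a b c
        ≡⟨ cong (cst 1ℚ a b c -_) (^ₛ-vanishes X X₀≡0 (suc d) a b c (n<1+n d)) ⟩
      cst 1ℚ a b c - 0ℚ
        ≡⟨ ℚ.+-identityʳ _ ⟩
      cst 1ℚ a b c
        ∎
      where
      open ≡-Reasoning
      d = a ℕ.+ b ℕ.+ c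

  invₛ-inverseˡ : ∀ F → F 0 0 0 ≢ 0ℚ → invₛ F ⊛ F ≈ₛ cst 1ℚ
  invₛ-inverseˡ F F₀≢0 = begin
    (cst r ⊛ geom X) ⊛ F
      ≈⟨ solve 3 (λ r g f → (r :* g) :* f := g :* (con 1ℚ :- (con 1ℚ :- r :* f))) Ser.refl (cst r) (geom X) F ⟩
    geom X ⊛ (cst 1ℚ ⊖ X)   ≈⟨ geom-inverse X X₀≡0 ⟩
    cst 1ℚ                  ∎
    where
    open import Relation.Binary.Reasoning.Setoid Ser.setoid
    r = recip (F 0 0 0)
    X = cst 1ℚ ⊖ cst r ⊛ F
    X₀≡0 : X 0 0 0 ≡ 0ℚ
    X₀≡0 = cong (1ℚ * 1ℚ -_) (≡.begin
      (cst r ⊛ F) 0 0 0        ≡.≡⟨ ⊛-origin (cst r) F ⟩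
      (r * 1ℚ) * F 0 0 0       ≡.≡⟨ cong (_* F 0 0 0) (*-identityʳ r) ⟩
      r * F 0 0 0              ≡.≡⟨ recip-inverseˡ F₀≢0 ⟩
      1ℚ                       ≡.∎)
      where module ≡ = ≡-Reasoning

  ⊛-cancelʳ : ∀ F G K → K 0 0 0 ≢ 0ℚ → F ⊛ K ≈ₛ G ⊛ K → F ≈ₛ G
  ⊛-cancelʳ F G K K₀≢0 FK≈GK = begin
    F                    ≈⟨ Ser.*-identityʳ F ⟨
    F ⊛ cst 1ℚ           ≈⟨ Ser.*-congˡ {F} (invₛ-inverseˡ K K₀≢0) ⟨
    F ⊛ (invₛ K ⊛ K)     ≈⟨ x∙yz≈xz∙y F (invₛ K) K ⟩
    (F ⊛ K) ⊛ invₛ K     ≈⟨ Ser.*-congʳ {invₛ K} FK≈GK ⟩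
    (G ⊛ K) ⊛ invₛ K     ≈⟨ x∙yz≈xz∙y G (invₛ K) K ⟨
    G ⊛ (invₛ K ⊛ K)     ≈⟨ Ser.*-congˡ {G} (invₛ-inverseˡ K K₀≢0) ⟩
    G ⊛ cst 1ℚ           ≈⟨ Ser.*-identityʳ G ⟩
    G                    ∎
    where
    open import Relation.Binary.Reasoning.Setoid Ser.setoid
    open import Algebra.Properties.CommutativeSemigroup Ser.*-commutativeSemigroup using (x∙yz≈xz∙y)

module Indices where

  open import Data.Bool.Base using (Bool; true; false; if_then_else_; _∧_)
  open import Data.Bool.Properties using (if-eta)
  open import Data.List.Base using (List; []; _∷_; map; concat; length; upTo; applyUpTo; _++_; filterᵇ)
  open import Data.Nat.Base as ℕ using (ℕ; zero; suc; _∸_; _≤_; _<_; s≤s; _≡ᵇ_)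
  import Data.Nat.Properties as ℕ
  open import Data.Sum.Base as Sum using (_⊎_; inj₁; inj₂)
  open import Data.Rational.Base using (ℚ; 0ℚ; _+_; _*_)
  import Data.Rational.Properties as ℚ
  open import Function.Base using (_∘_)
  open import Data.Nat.Tactic.RingSolver using (solve-∀)
  open import Relation.Binary.PropositionalEquality
  open import Defs
  open PrefixSums
  open ≡-Reasoning

  Σₗ : {A : Set} → (A → ℚ) → List A → ℚ
  Σₗ f xs = sumL (map f xs)

  module _ {A : Set} where

    Σₗ-cong : ∀ {f g : A → ℚ} xs → (∀ x → f x ≡ g x) → Σₗ f xs ≡ Σₗ g xs
    Σₗ-cong []       f≡g = refl
    Σₗ-cong (x ∷ xs) f≡g = cong₂ _+_ (f≡g x) (Σₗ-cong xs f≡g)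

    Σₗ-zero : ∀ {f : A → ℚ} xs → (∀ x → f x ≡ 0ℚ) → Σₗ f xs ≡ 0ℚ
    Σₗ-zero []       f≡0 = refl
    Σₗ-zero (x ∷ xs) f≡0 = cong₂ _+_ (f≡0 x) (Σₗ-zero xs f≡0)

    Σₗ-++ : ∀ (f : A → ℚ) xs ys → Σₗ f (xs ++ ys) ≡ Σₗ f xs + Σₗ f ys
    Σₗ-++ f []       ys = sym (ℚ.+-identityˡ _)
    Σₗ-++ f (x ∷ xs) ys = trans (cong (f x +_) (Σₗ-++ f xs ys)) (sym (ℚ.+-assoc (f x) _ _))

    Σₗ-concat : ∀ (f : A → ℚ) xss → Σₗ f (concat xss) ≡ Σₗ (Σₗ f) xss
    Σₗ-concat f []         = refl
    Σₗ-concat f (xs ∷ xss) = trans (Σₗ-++ f xs (concat xss)) (cong (Σₗ f xs +_) (Σₗ-concat f xss))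

    Σₗ-map : ∀ {B : Set} (f : B → ℚ) (g : A → B) xs → Σₗ f (map g xs) ≡ Σₗ (f ∘ g) xs
    Σₗ-map f g []       = refl
    Σₗ-map f g (x ∷ xs) = cong (f (g x) +_) (Σₗ-map f g xs)

    Σₗ-*ˡ : ∀ q (f : A → ℚ) xs → Σₗ (λ x → q * f x) xs ≡ q * Σₗ f xs
    Σₗ-*ˡ q f []       = sym (ℚ.*-zeroʳ q)
    Σₗ-*ˡ q f (x ∷ xs) = trans (cong (q * f x +_) (Σₗ-*ˡ q f xs)) (sym (ℚ.*-distribˡ-+ q (f x) _))

    Σₗ-+ : ∀ (f g : A → ℚ) xs → Σₗ (λ x → f x + g x) xs ≡ Σₗ f xs + Σₗ g xs
    Σₗ-+ f g []       = refl
    Σₗ-+ f g (x ∷ xs) = trans (cong (f x + g x +_) (Σₗ-+ f g xs)) (interchange (f x) (g x) _ _)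
      where
      open import Algebra.Bundles using (CommutativeRing)
      open import Algebra.Properties.CommutativeSemigroup
        (CommutativeRing.+-commutativeSemigroup ℚ.+-*-commutativeRing) using (interchange)

    Σₗ-filterᵇ : ∀ (g : A → ℚ) p xs → Σₗ g (filterᵇ p xs) ≡ Σₗ (λ x → if p x then g x else 0ℚ) xs
    Σₗ-filterᵇ g p []       = refl
    Σₗ-filterᵇ g p (x ∷ xs) with p x
    ... | true  = cong (g x +_) (Σₗ-filterᵇ g p xs)
    ... | false = trans (Σₗ-filterᵇ g p xs) (sym (ℚ.+-identityˡ _))

    filterᵇ-unique : ∀ p (filt : List A → List A) → filt [] ≡ [] →
                     (∀ x xs → filt (x ∷ xs) ≡ (if p x then x ∷ filt xs else filt xs)) →
                     ∀ xs → filt xs ≡ filterᵇ p xs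
    filterᵇ-unique p filt filt[] filt∷ []       = filt[]
    filterᵇ-unique p filt filt[] filt∷ (x ∷ xs) with p x | filt∷ x xs
    ... | true  | eq = trans eq (cong (x ∷_) (filterᵇ-unique p filt filt[] filt∷ xs))
    ... | false | eq = trans eq (filterᵇ-unique p filt filt[] filt∷ xs)

  Σₗ-applyUpTo : ∀ (f : ℕ → ℚ) g n → Σₗ f (applyUpTo g n) ≡ Σ< n (f ∘ g)
  Σₗ-applyUpTo f g zero    = refl
  Σₗ-applyUpTo f g (suc n) = trans (cong (f (g 0) +_) (Σₗ-applyUpTo f (g ∘ suc) n)) (sym (Σ<-first n (f ∘ g)))

  Σₗ-upTo : ∀ (f : ℕ → ℚ) n → Σₗ f (upTo n) ≡ Σ< n f
  Σₗ-upTo f = Σₗ-applyUpTo f (λ i → i)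

  Σcomp : (List ℕ → ℚ) → ℕ → ℕ → ℚ
  Σcomp F k n = Σₗ F (comps k n)

  Σcomp-suc : ∀ F k n → Σcomp F k (suc n) ≡ Σ< k (λ p → Σcomp (F ∘ (suc p ∷_)) (k ∸ suc p) n)
  Σcomp-suc F zero    n = refl
  Σcomp-suc F (suc k) n = begin
    Σₗ F (concat (map parts (upTo (suc k))))      ≡⟨ Σₗ-concat F (map parts (upTo (suc k))) ⟩
    Σₗ (Σₗ F) (map parts (upTo (suc k)))          ≡⟨ Σₗ-map (Σₗ F) parts (upTo (suc k)) ⟩
    Σₗ (Σₗ F ∘ parts) (upTo (suc k))              ≡⟨ Σₗ-upTo (Σₗ F ∘ parts) (suc k) ⟩
    Σ< (suc k) (Σₗ F ∘ parts)                     ≡⟨ Σ<-cong (suc k) (λ p _ → Σₗ-map F (suc p ∷_) (comps (k ∸ p) n)) ⟩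
    Σ< (suc k) (λ p → Σcomp (F ∘ (suc p ∷_)) (suc k ∸ suc p) n)
                                                  ∎
    where
    parts : ℕ → List (List ℕ)
    parts p = map (suc p ∷_) (comps (suc k ∸ suc p) n)

  -- Sum of F over the indices of weight k, depth n and height s (admissible or not).
  ΣI : (List ℕ → ℚ) → ℕ → ℕ → ℕ → ℚ
  ΣI F k n s = Σcomp (λ 𝐤 → if height 𝐤 ≡ᵇ s then F 𝐤 else 0ℚ) k n

  -- The part of ΣI F (suc k) (suc n) s coming from indices whose first entry is at least 2.
  ΣI⁺ : (List ℕ → ℚ) → ℕ → ℕ → ℕ → ℚ
  ΣI⁺ F k n s = Σ< k λ p →
    Σcomp (λ 𝐤 → if suc (height 𝐤) ≡ᵇ s then F (suc (suc p) ∷ 𝐤) else 0ℚ) (k ∸ suc p) n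

  ΣI-split : ∀ F k n s → ΣI F (suc k) (suc n) s ≡ ΣI (F ∘ (1 ∷_)) k n s + ΣI⁺ F k n s
  ΣI-split F k n s = trans (Σcomp-suc _ (suc k) n) (Σ<-first k _)

  ΣI⁺-zero : ∀ F k n → ΣI⁺ F k n 0 ≡ 0ℚ
  ΣI⁺-zero F k n = Σ<-zero k λ p _ → Σₗ-zero (comps (k ∸ suc p) n) λ _ → refl

  ΣI⁺-suc : ∀ F k n s → ΣI⁺ F (suc k) n (suc s) ≡ Σ< (suc k) (λ p → ΣI (F ∘ (suc (suc p) ∷_)) (k ∸ p) n s)
  ΣI⁺-suc F k n s = refl

  ΣI-cong : ∀ {F G} k n s → (∀ 𝐤 → F 𝐤 ≡ G 𝐤) → ΣI F k n s ≡ ΣI G k n s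
  ΣI-cong k n s F≡G = Σₗ-cong (comps k n) λ 𝐤 → cong (if height 𝐤 ≡ᵇ s then_else 0ℚ) (F≡G 𝐤)

  ΣI-*ˡ : ∀ q F k n s → ΣI (λ 𝐤 → q * F 𝐤) k n s ≡ q * ΣI F k n s
  ΣI-*ˡ q F k n s = trans (Σₗ-cong (comps k n) λ 𝐤 → if-float-* (height 𝐤 ≡ᵇ s)) (Σₗ-*ˡ q _ (comps k n))
    where
    if-float-* : ∀ b {x} → (if b then q * x else 0ℚ) ≡ q * (if b then x else 0ℚ)
    if-float-* true  = refl
    if-float-* false = sym (ℚ.*-zeroʳ q)

  ΣI-+ : ∀ F G k n s → ΣI (λ 𝐤 → F 𝐤 + G 𝐤) k n s ≡ ΣI F k n s + ΣI G k n s
  ΣI-+ F G k n s = trans (Σₗ-cong (comps k n) λ 𝐤 → if-float-+ (height 𝐤 ≡ᵇ s)) (Σₗ-+ _ _ (comps k n))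
    where
    if-float-+ : ∀ b {x y} → (if b then x + y else 0ℚ) ≡ (if b then x else 0ℚ) + (if b then y else 0ℚ)
    if-float-+ true  = refl
    if-float-+ false = refl

  ΣI-zero : ∀ {F} k n s → (∀ 𝐤 → F 𝐤 ≡ 0ℚ) → ΣI F k n s ≡ 0ℚ
  ΣI-zero k n s F≡0 = Σₗ-zero (comps k n) λ 𝐤 → trans (cong (if height 𝐤 ≡ᵇ s then_else 0ℚ) (F≡0 𝐤)) (if-eta _)

  ΣI-cons-zero : ∀ {F} k n s → (∀ k 𝐤 → F (k ∷ 𝐤) ≡ 0ℚ) → ΣI F k (suc n) s ≡ 0ℚ
  ΣI-cons-zero k n s F∷≡0 = trans (Σcomp-suc _ k n) (Σ<-zero k λ p _ → Σₗ-zero (comps (k ∸ suc p) n) λ 𝐤 →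
    trans (cong (if height (suc p ∷ 𝐤) ≡ᵇ s then_else 0ℚ) (F∷≡0 (suc p) 𝐤)) (if-eta _))

  -- An index of depth n and height s has weight at least n + s, and s ≤ n.
  ΣI-vanishes : ∀ n k s F → k < n ℕ.+ s ⊎ n < s → ΣI F k n s ≡ 0ℚ
  ΣI-vanishes zero    zero    zero    F (inj₁ ())
  ΣI-vanishes zero    zero    zero    F (inj₂ ())
  ΣI-vanishes zero    zero    (suc s) F _ = refl
  ΣI-vanishes zero    (suc k) s       F _ = refl
  ΣI-vanishes (suc n) k       s       F too-small =
    trans (Σcomp-suc _ k n) (Σ<-zero k λ p p<k → first-part s p p<k too-small)
    where
    first-part : ∀ s p → p < k → k < suc n ℕ.+ s ⊎ suc n < s →
                 Σcomp (λ 𝐤 → if height (suc p ∷ 𝐤) ≡ᵇ s then F (suc p ∷ 𝐤) else 0ℚ) (k ∸ suc p) n ≡ 0ℚ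
    first-part s       zero    0<k too-small =
      ΣI-vanishes n (k ∸ 1) s (F ∘ (1 ∷_)) (Sum.map (∸1-< 0<k) ℕ.<⇒≤ too-small)
      where
      ∸1-< : ∀ {k} → 0 < k → k < suc n ℕ.+ s → k ∸ 1 < n ℕ.+ s
      ∸1-< {suc k} _ (s≤s k<n+s) = k<n+s
    first-part zero    (suc p) _   _         = Σₗ-zero (comps (k ∸ suc (suc p)) n) λ _ → refl
    first-part (suc s) (suc p) p<k too-small =
      ΣI-vanishes n (k ∸ suc (suc p)) s (F ∘ (suc (suc p) ∷_)) (Sum.map (∸2+p-< p<k) ℕ.≤-pred too-small)
      where
      ∸2+p-< : ∀ {k} → suc p < k → k < suc n ℕ.+ suc s → k ∸ suc (suc p) < n ℕ.+ s
      ∸2+p-< {suc zero}    (s≤s ()) _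
      ∸2+p-< {suc (suc k)} _ (s≤s k<n+1+s) =
        ℕ.≤-<-trans (ℕ.m∸n≤m k p) (ℕ.≤-pred (subst (suc (suc k) ≤_) (ℕ.+-suc n s) k<n+1+s))

  infixr 8 _^⁻_
  _^⁻_ : ℕ → ℕ → ℚ
  m ^⁻ k = recip (ℕ→ℚ (m ℕ.^ k))

  -- t⋆ x 𝐤 = Σ_{x ≥ m₁ ≥ ⋯ ≥ mₙ > 0, mᵢ odd} m₁^{-k₁} ⋯ mₙ^{-kₙ}: the sum of the coefficients
  -- of z, z², …, z^x in 𝓛⋆_𝐤.
  t⋆ : ℕ → List ℕ → ℚ
  t⋆ x 𝐤 = Σₗ (λ ms → term ms 𝐤) (downSeqs x (length 𝐤))

  t⋆-∷ : ∀ x k 𝐤 → t⋆ x (k ∷ 𝐤) ≡ Σ< x (λ p → Lcoef (k ∷ 𝐤) (suc p))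
  t⋆-∷ x k 𝐤 = begin
    Σₗ f (concat (map parts (upTo x)))          ≡⟨ Σₗ-concat f (map parts (upTo x)) ⟩
    Σₗ (Σₗ f) (map parts (upTo x))              ≡⟨ Σₗ-map (Σₗ f) parts (upTo x) ⟩
    Σₗ (Σₗ f ∘ parts) (upTo x)                  ≡⟨ Σₗ-upTo (Σₗ f ∘ parts) x ⟩
    Σ< x (Σₗ f ∘ parts)                         ≡⟨ Σ<-cong x (λ p _ → from-parts p) ⟩
    Σ< x (λ p → Lcoef (k ∷ 𝐤) (suc p))          ∎
    where
    f : List ℕ → ℚ
    f ms = term ms (k ∷ 𝐤)
    parts : ℕ → List (List ℕ)
    parts p = if odd (suc p) then map (suc p ∷_) (downSeqs (suc p) (length 𝐤)) else []
    from-parts : ∀ p → Σₗ f (parts p) ≡ Lcoef (k ∷ 𝐤) (suc p)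
    from-parts p with odd (suc p)
    ... | true  = Σₗ-map f (suc p ∷_) (downSeqs (suc p) (length 𝐤))
    ... | false = refl

  t⋆-suc : ∀ x 𝐤 → t⋆ (suc x) 𝐤 ≡ t⋆ x 𝐤 + Lcoef 𝐤 (suc x)
  t⋆-suc x []      = refl
  t⋆-suc x (k ∷ 𝐤) = trans (t⋆-∷ (suc x) k 𝐤) (cong (_+ Lcoef (k ∷ 𝐤) (suc x)) (sym (t⋆-∷ x k 𝐤)))

  Lcoef-odd : ∀ {m} → odd m ≡ true → ∀ k 𝐤 → Lcoef (k ∷ 𝐤) m ≡ m ^⁻ k * t⋆ m 𝐤
  Lcoef-odd {m} odd-m k 𝐤 rewrite odd-m = Σₗ-*ˡ (m ^⁻ k) (λ ms → term ms 𝐤) (downSeqs m (length 𝐤))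

  Lcoef-even : ∀ {m} → odd m ≡ false → ∀ 𝐤 → Lcoef 𝐤 m ≡ 0ℚ
  Lcoef-even even-m []      = refl
  Lcoef-even even-m (k ∷ 𝐤) rewrite even-m = refl

  -- The filter in I₀ is local to its definition; its defining equations identify it with filterᵇ.
  I₀≡filterᵇ : ∀ k n s → I₀ k n s ≡ filterᵇ (λ 𝐤 → admissible 𝐤 ∧ (height 𝐤 ≡ᵇ s)) (comps k n)
  I₀≡filterᵇ k n s with comps k n | filterᵇ-unique (λ 𝐤 → admissible 𝐤 ∧ (height 𝐤 ≡ᵇ s)) _ refl (λ _ _ → refl)
  ... | 𝐤s | filt≡filterᵇ = filt≡filterᵇ 𝐤s

  -- In the coordinates of Φcoef: u^a v^b w^c records weight a + b + 2c, depth b + c and height c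
  -- (or c + 1 for Φcoef, whose w-exponent is the height minus one).
  weight : ℕ → ℕ → ℕ → ℕ
  weight a b c = a ℕ.+ b ℕ.+ c ℕ.+ c

  weight-sucᵇ : ∀ a b c → weight a (suc b) c ≡ suc (weight a b c)
  weight-sucᵇ a b c = cong (λ n → n ℕ.+ c ℕ.+ c) (ℕ.+-suc a b)

  weight-sucᶜ : ∀ a b c → weight a b (suc c) ≡ suc (weight a (suc b) c)
  weight-sucᶜ = arithmetic
    where
    arithmetic : ∀ a b c → a ℕ.+ b ℕ.+ suc c ℕ.+ suc c ≡ suc (a ℕ.+ suc b ℕ.+ c ℕ.+ c)
    arithmetic = solve-∀

  -- Φcoef keeps the admissible indices, i.e. those whose first entry is at least 2.
  Φcoef≡ΣI⁺ : ∀ m a b c → Φcoef m a b c ≡ ΣI⁺ (λ 𝐤 → Lcoef 𝐤 m) (suc (weight a b c)) (b ℕ.+ c) (suc c)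
  Φcoef≡ΣI⁺ m a b c = begin
    Φcoef m a b c
      ≡⟨ cong (Σₗ (λ 𝐤 → Lcoef 𝐤 m)) (I₀≡filterᵇ (a ℕ.+ n ℕ.+ suc c) n (suc c)) ⟩
    Σₗ (λ 𝐤 → Lcoef 𝐤 m) (filterᵇ (λ 𝐤 → admissible 𝐤 ∧ (height 𝐤 ≡ᵇ suc c)) (comps (a ℕ.+ n ℕ.+ suc c) n))
      ≡⟨ Σₗ-filterᵇ (λ 𝐤 → Lcoef 𝐤 m) _ (comps (a ℕ.+ n ℕ.+ suc c) n) ⟩
    Σcomp (λ 𝐤 → if admissible 𝐤 ∧ (height 𝐤 ≡ᵇ suc c) then Lcoef 𝐤 m else 0ℚ) (a ℕ.+ n ℕ.+ suc c) n
      ≡⟨ cong₂ (Σcomp _) (Φcoef-weight a b c) (ℕ.+-suc b c) ⟩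
    Σcomp (λ 𝐤 → if admissible 𝐤 ∧ (height 𝐤 ≡ᵇ suc c) then Lcoef 𝐤 m else 0ℚ) (suc (suc K)) (suc N)
      ≡⟨ trans (Σcomp-suc _ (suc (suc K)) N) (Σ<-first (suc K) _) ⟩
    Σcomp (λ _ → 0ℚ) (suc K) N + ΣI⁺ (λ 𝐤 → Lcoef 𝐤 m) (suc K) N (suc c)
      ≡⟨ cong (_+ ΣI⁺ (λ 𝐤 → Lcoef 𝐤 m) (suc K) N (suc c)) (Σₗ-zero (comps (suc K) N) λ _ → refl) ⟩
    0ℚ + ΣI⁺ (λ 𝐤 → Lcoef 𝐤 m) (suc K) N (suc c)
      ≡⟨ ℚ.+-identityˡ _ ⟩
    ΣI⁺ (λ 𝐤 → Lcoef 𝐤 m) (suc K) N (suc c) ∎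
    where
    K = weight a b c
    N = b ℕ.+ c
    n = b ℕ.+ suc c
    Φcoef-weight : ∀ a b c → a ℕ.+ (b ℕ.+ suc c) ℕ.+ suc c ≡ suc (suc (a ℕ.+ b ℕ.+ c ℕ.+ c))
    Φcoef-weight = solve-∀

  Φcoef-even : ∀ {m} → odd m ≡ false → ∀ a b c → Φcoef m a b c ≡ 0ℚ
  Φcoef-even even a b c = Σₗ-zero (I₀ (a ℕ.+ (b ℕ.+ suc c) ℕ.+ suc c) (b ℕ.+ suc c) (suc c)) (Lcoef-even even)

module GeneratingFunctions where

  open import Data.Bool.Base using (true; false)
  open import Data.List.Base using (List; _∷_)
  open import Data.Nat.Base as ℕ using (ℕ; zero; suc; _∸_; _≤_; _<_; NonZero)
  import Data.Nat.Properties as ℕ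
  open import Data.Rational.Base using (ℚ; 0ℚ; 1ℚ; _+_; _*_; _-_)
  import Data.Rational.Properties as ℚ
  open import Data.Sum.Base using (inj₁; inj₂)
  open import Relation.Binary.PropositionalEquality
  open import Defs
  open PrefixSums
  open RationalFacts
  open Trivariate
  open Indices
  open Parity using (odd⇒nonZero)
  open SerSolver using (solve; _:=_; _:*_; _:-_)

  ^⁻-suc : ∀ x .{{_ : NonZero x}} k → x ^⁻ suc k ≡ recip (ℕ→ℚ x) * x ^⁻ k
  ^⁻-suc x k = trans (cong recip (ℕ→ℚ-* x (x ℕ.^ k)))
                     (recip-* (ℕ→ℚ-≢0 x) (ℕ→ℚ-≢0 (x ℕ.^ k) {{ℕ.m^n≢0 x k}}))

  -- T x = Σ_𝐤 t⋆ x 𝐤 u^{k−n−s} v^{n−s} w^s over all indices 𝐤 (also non-admissible and empty ones),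
  -- and Λ m is the same sum with the coefficient of z^m in 𝓛⋆_𝐤 in place of t⋆ x 𝐤.
  T Λ : ℕ → Ser
  T x a b c = ΣI (t⋆ x) (weight a b c) (b ℕ.+ c) c
  Λ m a b c = ΣI (λ 𝐤 → Lcoef 𝐤 m) (weight a b c) (b ℕ.+ c) c

  T-suc : ∀ x → T (suc x) ≈ₛ T x ⊕ Λ (suc x)
  T-suc x a b c = trans (ΣI-cong (weight a b c) (b ℕ.+ c) c (t⋆-suc x))
                        (ΣI-+ (t⋆ x) (λ 𝐤 → Lcoef 𝐤 (suc x)) (weight a b c) (b ℕ.+ c) c)

  T-zero : T 0 ≈ₛ cst 1ℚ
  T-zero zero    zero    zero    = refl
  T-zero (suc a) zero    zero    = refl
  T-zero zero    (suc b) c       = ΣI-cons-zero (weight 0 (suc b) c) (b ℕ.+ c) c (t⋆-∷ 0)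
  T-zero (suc a) (suc b) c       = ΣI-cons-zero (weight (suc a) (suc b) c) (b ℕ.+ c) c (t⋆-∷ 0)
  T-zero zero    zero    (suc c) = ΣI-cons-zero (weight 0 0 (suc c)) c (suc c) (t⋆-∷ 0)
  T-zero (suc a) zero    (suc c) = ΣI-cons-zero (weight (suc a) 0 (suc c)) c (suc c) (t⋆-∷ 0)

  Λ-even : ∀ {m} → odd m ≡ false → Λ m ≈ₛ S₂.𝟘
  Λ-even even-m a b c = ΣI-zero (weight a b c) (b ℕ.+ c) c (Lcoef-even even-m)

  -- Mₛ R = R² − Ru and Nₛ R = R² − Ru − (R − u)v − w; with R = 2j + 1 these are the factors
  -- 4((1−u)/2 + j)(1/2 + j) of the numerator and 4(α⋆ + j − 1)(β⋆ + j − 1) of the denominator.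
  Mₛ Nₛ : Ser → Ser
  Mₛ R = R ⊛ R ⊖ R ⊛ U
  Nₛ R = Mₛ R ⊖ (R ⊖ U) ⊛ V ⊖ W

  M N : ℚ → Ser
  M q = Mₛ (cst q)
  N q = Nₛ (cst q)

  M-origin : ∀ q → M q 0 0 0 ≡ q * q
  M-origin q = begin
    (cst q ⊛ cst q) 0 0 0 - (cst q ⊛ U) 0 0 0  ≡⟨ cong₂ _-_ (⊛-origin (cst q) (cst q)) (⊛-origin (cst q) U) ⟩
    (q * 1ℚ) * (q * 1ℚ) - (q * 1ℚ) * 0ℚ        ≡⟨ cong₂ _-_ (cong₂ _*_ (ℚ.*-identityʳ q) (ℚ.*-identityʳ q))
                                                           (ℚ.*-zeroʳ (q * 1ℚ)) ⟩
    q * q - 0ℚ                                 ≡⟨ ℚ.+-identityʳ (q * q) ⟩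
    q * q                                      ∎
    where open ≡-Reasoning

  N-origin : ∀ q → N q 0 0 0 ≡ q * q
  N-origin q = begin
    M q 0 0 0 - ((cst q ⊖ U) ⊛ V) 0 0 0 - 0ℚ       ≡⟨ ℚ.+-identityʳ _ ⟩
    M q 0 0 0 - ((cst q ⊖ U) ⊛ V) 0 0 0            ≡⟨ cong₂ _-_ (M-origin q) (⊛-origin-zeroʳ (cst q ⊖ U) {V} refl) ⟩
    q * q - 0ℚ                                     ≡⟨ ℚ.+-identityʳ (q * q) ⟩
    q * q                                          ∎
    where open ≡-Reasoning

  module _ {m} (odd-m : odd m ≡ true) where

    private
      instance
        m≢0 : NonZero m
        m≢0 = odd⇒nonZero odd-m
      r r⁻¹ : ℚ
      r = ℕ→ℚ m
      r⁻¹ = recip r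
      r⁻¹r≡1 : r⁻¹ * r ≡ 1ℚ
      r⁻¹r≡1 = recip-inverseˡ (ℕ→ℚ-≢0 m)
      m^⁻2 : m ^⁻ 2 ≡ r⁻¹ * r⁻¹
      m^⁻2 = trans (^⁻-suc m 1) (cong (r⁻¹ *_) (trans (^⁻-suc m 0) (ℚ.*-identityʳ r⁻¹)))
      Lₘ : List ℕ → ℚ
      Lₘ 𝐤 = Lcoef 𝐤 m

    -- Split by the first entry of the index: 1 contributes v/m · T m, and entries ≥ 2 contribute w · Φ.
    Λ-split : ∀ k n s → ΣI Lₘ (suc k) (suc n) s ≡ r⁻¹ * ΣI (t⋆ m) k n s + ΣI⁺ Lₘ k n s
    Λ-split k n s = trans (ΣI-split Lₘ k n s) (cong (_+ ΣI⁺ Lₘ k n s) (begin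
      ΣI (λ 𝐤 → Lcoef (1 ∷ 𝐤) m) k n s   ≡⟨ ΣI-cong k n s (Lcoef-odd odd-m 1) ⟩
      ΣI (λ 𝐤 → m ^⁻ 1 * t⋆ m 𝐤) k n s  ≡⟨ ΣI-*ˡ (m ^⁻ 1) (t⋆ m) k n s ⟩
      m ^⁻ 1 * ΣI (t⋆ m) k n s           ≡⟨ cong (_* ΣI (t⋆ m) k n s) (trans (^⁻-suc m 0) (ℚ.*-identityʳ r⁻¹)) ⟩
      r⁻¹ * ΣI (t⋆ m) k n s              ∎))
      where open ≡-Reasoning

    Λ-odd-coeff : ∀ a b c → Λ m a b c ≡ r⁻¹ * shiftV (T m) a b c + shiftW (Φcoef m) a b c
    Λ-odd-coeff zero    zero    zero    = sym (trans (ℚ.+-identityʳ _) (ℚ.*-zeroʳ r⁻¹))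
    Λ-odd-coeff (suc a) zero    zero    = sym (trans (ℚ.+-identityʳ _) (ℚ.*-zeroʳ r⁻¹))
    Λ-odd-coeff a       (suc b) zero    = begin
      Λ m a (suc b) 0
        ≡⟨ cong (λ k → ΣI Lₘ k (suc b ℕ.+ 0) 0) (weight-sucᵇ a b 0) ⟩
      ΣI Lₘ (suc (weight a b 0)) (suc (b ℕ.+ 0)) 0
        ≡⟨ Λ-split (weight a b 0) (b ℕ.+ 0) 0 ⟩
      r⁻¹ * T m a b 0 + ΣI⁺ Lₘ (weight a b 0) (b ℕ.+ 0) 0
        ≡⟨ cong (r⁻¹ * T m a b 0 +_) (ΣI⁺-zero Lₘ (weight a b 0) (b ℕ.+ 0)) ⟩
      r⁻¹ * T m a b 0 + 0ℚ
        ∎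
      where open ≡-Reasoning
    Λ-odd-coeff a       (suc b) (suc c) = begin
      Λ m a (suc b) (suc c)
        ≡⟨ cong (λ k → ΣI Lₘ k (suc b ℕ.+ suc c) (suc c)) (weight-sucᵇ a b (suc c)) ⟩
      ΣI Lₘ (suc (weight a b (suc c))) (suc (b ℕ.+ suc c)) (suc c)
        ≡⟨ Λ-split (weight a b (suc c)) (b ℕ.+ suc c) (suc c) ⟩
      r⁻¹ * T m a b (suc c) + ΣI⁺ Lₘ (weight a b (suc c)) (b ℕ.+ suc c) (suc c)
        ≡⟨ cong (r⁻¹ * T m a b (suc c) +_) (cong₂ (λ k n → ΣI⁺ Lₘ k n (suc c)) (weight-sucᶜ a b c) (ℕ.+-suc b c)) ⟩
      r⁻¹ * T m a b (suc c) + ΣI⁺ Lₘ (suc (weight a (suc b) c)) (suc b ℕ.+ c) (suc c)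
        ≡⟨ cong (r⁻¹ * T m a b (suc c) +_) (Φcoef≡ΣI⁺ m a (suc b) c) ⟨
      r⁻¹ * T m a b (suc c) + Φcoef m a (suc b) c
        ∎
      where open ≡-Reasoning
    Λ-odd-coeff a       zero    (suc c) = begin
      Λ m a 0 (suc c)
        ≡⟨ cong (λ k → ΣI Lₘ k (suc c) (suc c)) (weight-sucᶜ a 0 c) ⟩
      ΣI Lₘ (suc (weight a 1 c)) (suc c) (suc c)
        ≡⟨ Λ-split (weight a 1 c) c (suc c) ⟩
      r⁻¹ * ΣI (t⋆ m) (weight a 1 c) c (suc c) + ΣI⁺ Lₘ (weight a 1 c) c (suc c)
        ≡⟨ cong₂ _+_ (cong (r⁻¹ *_) (ΣI-vanishes c (weight a 1 c) (suc c) (t⋆ m) (inj₂ (ℕ.n<1+n c))))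
                     (cong (λ k → ΣI⁺ Lₘ k c (suc c)) (weight-sucᵇ a 0 c)) ⟩
      r⁻¹ * 0ℚ + ΣI⁺ Lₘ (suc (weight a 0 c)) c (suc c)
        ≡⟨ cong (r⁻¹ * 0ℚ +_) (Φcoef≡ΣI⁺ m a 0 c) ⟨
      r⁻¹ * 0ℚ + Φcoef m a 0 c
        ∎
      where open ≡-Reasoning

    Λ-odd : Λ m ≈ₛ cst r⁻¹ ⊛ (T m ⊛ V) ⊕ Φcoef m ⊛ W
    Λ-odd a b c = trans (Λ-odd-coeff a b c) (sym (cong₂ _+_
      (trans (cst-scale r⁻¹ (T m ⊛ V) a b c) (cong (r⁻¹ *_) (⊛V (T m) a b c)))
      (⊛W (Φcoef m) a b c)))

    Φsum : ℕ → ℕ → ℕ → ℚ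
    Φsum k n s = Σ< (suc k) (λ p → m ^⁻ suc (suc p) * ΣI (t⋆ m) (k ∸ p) n s)

    Φcoef≡Φsum : ∀ a b c → Φcoef m a b c ≡ Φsum (weight a b c) (b ℕ.+ c) c
    Φcoef≡Φsum a b c = begin
      Φcoef m a b c
        ≡⟨ Φcoef≡ΣI⁺ m a b c ⟩
      ΣI⁺ Lₘ (suc k) n (suc c)
        ≡⟨ ΣI⁺-suc Lₘ k n c ⟩
      Σ< (suc k) (λ p → ΣI (λ 𝐤 → Lcoef (suc (suc p) ∷ 𝐤) m) (k ∸ p) n c)
        ≡⟨ Σ<-cong (suc k) (λ p _ → trans (ΣI-cong (k ∸ p) n c (Lcoef-odd odd-m (suc (suc p))))
                                           (ΣI-*ˡ (m ^⁻ suc (suc p)) (t⋆ m) (k ∸ p) n c)) ⟩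
      Φsum k n c
        ∎
      where
      open ≡-Reasoning
      k = weight a b c
      n = b ℕ.+ c

    Φsum-suc : ∀ k n s → Φsum (suc k) n s ≡ m ^⁻ 2 * ΣI (t⋆ m) (suc k) n s + r⁻¹ * Φsum k n s
    Φsum-suc k n s = trans (Σ<-first (suc k) _) (cong (m ^⁻ 2 * ΣI (t⋆ m) (suc k) n s +_) (begin
      Σ< (suc k) (λ p → m ^⁻ suc (suc (suc p)) * ΣI (t⋆ m) (k ∸ p) n s)
        ≡⟨ Σ<-cong (suc k) (λ p _ → trans (cong (_* ΣI (t⋆ m) (k ∸ p) n s) (^⁻-suc m (suc (suc p))))
                                          (ℚ.*-assoc r⁻¹ _ _)) ⟩
      Σ< (suc k) (λ p → r⁻¹ * (m ^⁻ suc (suc p) * ΣI (t⋆ m) (k ∸ p) n s))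
        ≡⟨ Σ<-*ˡ (suc k) r⁻¹ _ ⟩
      r⁻¹ * Φsum k n s ∎))
      where open ≡-Reasoning

    Φsum-low : ∀ k n s → k ≤ n ℕ.+ s → Φsum k n s ≡ m ^⁻ 2 * ΣI (t⋆ m) k n s
    Φsum-low k n s k≤n+s =
      trans (Σ<-first k _) (trans (cong (m ^⁻ 2 * ΣI (t⋆ m) k n s +_) higher≡0) (ℚ.+-identityʳ _))
      where
      higher≡0 : Σ< k (λ p → m ^⁻ suc (suc (suc p)) * ΣI (t⋆ m) (k ∸ suc p) n s) ≡ 0ℚ
      higher≡0 = Σ<-zero k λ p p<k →
        trans (cong (m ^⁻ suc (suc (suc p)) *_)
                    (ΣI-vanishes n (k ∸ suc p) s (t⋆ m) (inj₁ (ℕ.<-≤-trans (∸-< p<k) k≤n+s))))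
              (ℚ.*-zeroʳ (m ^⁻ suc (suc (suc p))))
        where
        ∸-< : ∀ {p k} → p < k → k ∸ suc p < k
        ∸-< {p} {suc k} (ℕ.s≤s _) = ℕ.s≤s (ℕ.m∸n≤m k p)

    Φ-coeff-recurrence : ∀ a b c → (r * r) * Φcoef m a b c - r * shiftU (Φcoef m) a b c ≡ T m a b c
    Φ-coeff-recurrence zero b c = begin
      (r * r) * Φcoef m 0 b c - r * 0ℚ                        ≡⟨ cong (λ φ → (r * r) * φ - r * 0ℚ) Φ-zero ⟩
      (r * r) * ((r⁻¹ * r⁻¹) * T m 0 b c + r⁻¹ * 0ℚ) - r * 0ℚ ≡⟨ r²[i²t+iφ]-rφ≡t r r⁻¹ (T m 0 b c) 0ℚ r⁻¹r≡1 ⟩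
      T m 0 b c                                               ∎
      where
      open ≡-Reasoning
      Φ-zero : Φcoef m 0 b c ≡ (r⁻¹ * r⁻¹) * T m 0 b c + r⁻¹ * 0ℚ
      Φ-zero = begin
        Φcoef m 0 b c                        ≡⟨ Φcoef≡Φsum 0 b c ⟩
        Φsum (weight 0 b c) (b ℕ.+ c) c      ≡⟨ Φsum-low (weight 0 b c) (b ℕ.+ c) c ℕ.≤-refl ⟩
        m ^⁻ 2 * T m 0 b c                   ≡⟨ cong (_* T m 0 b c) m^⁻2 ⟩
        (r⁻¹ * r⁻¹) * T m 0 b c              ≡⟨ ℚ.+-identityʳ _ ⟨
        (r⁻¹ * r⁻¹) * T m 0 b c + 0ℚ         ≡⟨ cong ((r⁻¹ * r⁻¹) * T m 0 b c +_) (ℚ.*-zeroʳ r⁻¹) ⟨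
        (r⁻¹ * r⁻¹) * T m 0 b c + r⁻¹ * 0ℚ   ∎
    Φ-coeff-recurrence (suc a) b c = begin
      (r * r) * Φcoef m (suc a) b c - r * φ        ≡⟨ cong (λ x → (r * r) * x - r * φ) Φ-suc ⟩
      (r * r) * ((r⁻¹ * r⁻¹) * t + r⁻¹ * φ) - r * φ ≡⟨ r²[i²t+iφ]-rφ≡t r r⁻¹ t φ r⁻¹r≡1 ⟩
      t                                            ∎
      where
      open ≡-Reasoning
      t = T m (suc a) b c
      φ = Φcoef m a b c
      Φ-suc : Φcoef m (suc a) b c ≡ (r⁻¹ * r⁻¹) * t + r⁻¹ * φ
      Φ-suc = begin
        Φcoef m (suc a) b c                                ≡⟨ Φcoef≡Φsum (suc a) b c ⟩
        Φsum (suc (weight a b c)) (b ℕ.+ c) c              ≡⟨ Φsum-suc (weight a b c) (b ℕ.+ c) c ⟩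
        m ^⁻ 2 * t + r⁻¹ * Φsum (weight a b c) (b ℕ.+ c) c ≡⟨ cong₂ (λ x y → x * t + r⁻¹ * y) m^⁻2 Φsum≡φ ⟩
        (r⁻¹ * r⁻¹) * t + r⁻¹ * φ                          ∎
        where Φsum≡φ = sym (Φcoef≡Φsum a b c)

    Φ⊛M≈T : Φcoef m ⊛ M r ≈ₛ T m
    Φ⊛M≈T = begin
      Φcoef m ⊛ (cst r ⊛ cst r ⊖ cst r ⊛ U)
        ≈⟨ solve 3 (λ φ ρ u → φ :* (ρ :* ρ :- ρ :* u) := (ρ :* ρ) :* φ :- ρ :* (φ :* u)) Ser.refl (Φcoef m) (cst r) U ⟩
      (cst r ⊛ cst r) ⊛ Φcoef m ⊖ cst r ⊛ (Φcoef m ⊛ U)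
        ≈⟨ Ser.+-cong (Ser.*-congʳ {Φcoef m} (cst-* r r)) (Ser.-‿cong (Ser.*-congˡ {cst r} (⊛U (Φcoef m)))) ⟩
      cst (r * r) ⊛ Φcoef m ⊖ cst r ⊛ shiftU (Φcoef m)
        ≈⟨ (λ a b c → cong₂ _-_ (cst-scale (r * r) (Φcoef m) a b c) (cst-scale r (shiftU (Φcoef m)) a b c)) ⟩
      (λ a b c → (r * r) * Φcoef m a b c - r * shiftU (Φcoef m) a b c)
        ≈⟨ Φ-coeff-recurrence ⟩
      T m ∎
      where open import Relation.Binary.Reasoning.Setoid Ser.setoid

module Products where

  open import Data.Bool.Base using (true; false)
  open import Data.Nat.Base as ℕ using (ℕ; zero; suc)
  import Data.Nat.Properties as ℕ
  open import Data.Rational.Base using (0ℚ; 1ℚ; _*_)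
  import Data.Rational.Properties as ℚ
  open import Relation.Binary.PropositionalEquality
  open import Function.Base using (_∘_)
  open import Defs
  open RationalFacts
  open Trivariate
  open Parity
  open GeneratingFunctions
  open SerSolver using (solve; _:=_; _:+_; _:*_; _:-_)
  open import Relation.Binary.Reasoning.Setoid Ser.setoid

  recip⊛M : ∀ {q} → q ≢ 0ℚ → cst (recip q) ⊛ M q ≈ₛ cst q ⊖ U
  recip⊛M {q} q≢0 = begin
    cst (recip q) ⊛ (cst q ⊛ cst q ⊖ cst q ⊛ U)
      ≈⟨ solve 3 (λ i q u → i :* (q :* q :- q :* u) := (i :* q) :* q :- (i :* q) :* u) Ser.refl
                 (cst (recip q)) (cst q) U ⟩
    (cst (recip q) ⊛ cst q) ⊛ cst q ⊖ (cst (recip q) ⊛ cst q) ⊛ U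
      ≈⟨ Ser.+-cong (Ser.*-congʳ {cst q} iq≈1) (Ser.-‿cong (Ser.*-congʳ {U} iq≈1)) ⟩
    cst 1ℚ ⊛ cst q ⊖ cst 1ℚ ⊛ U
      ≈⟨ Ser.+-cong (Ser.*-identityˡ (cst q)) (Ser.-‿cong (Ser.*-identityˡ U)) ⟩
    cst q ⊖ U ∎
    where
    iq≈1 : cst (recip q) ⊛ cst q ≈ₛ cst 1ℚ
    iq≈1 = Ser.trans (cst-* (recip q) q) (cst-cong (recip-inverseˡ q≢0))

  T-step-even : ∀ {y} → odd (suc y) ≡ false → T (suc y) ≈ₛ T y
  T-step-even {y} even = begin
    T (suc y)              ≈⟨ T-suc y ⟩
    T y ⊕ Λ (suc y)        ≈⟨ Ser.+-congˡ {T y} (Λ-even {suc y} even) ⟩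
    T y ⊕ S₂.𝟘             ≈⟨ Ser.+-identityʳ (T y) ⟩
    T y                    ∎

  -- Since Φ ⊛ M r = T (suc y) and M r / r = r − u, multiplying Λ (suc y) = v T (suc y) / r + w Φ
  -- by M r gives T (suc y) ((r − u) v + w) = T (suc y) (M r − N r).
  T-step-odd : ∀ {y} → odd (suc y) ≡ true → T (suc y) ⊛ N (ℕ→ℚ (suc y)) ≈ₛ T y ⊛ M (ℕ→ℚ (suc y))
  T-step-odd {y} odd-1+y = begin
    T₁ ⊛ N r
      ≈⟨ solve 4 (λ t m e w → t :* (m :- e :- w) := t :* m :- t :* (e :+ w)) Ser.refl T₁ (M r) E W ⟩
    T₁ ⊛ M r ⊖ T₁ ⊛ (E ⊕ W)
      ≈⟨ Ser.+-cong (Ser.*-congʳ {M r} (T-suc y)) (Ser.-‿cong (Ser.sym Λ⊛M≈T₁⊛[E+W])) ⟩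
    (T y ⊕ Λ₁) ⊛ M r ⊖ Λ₁ ⊛ M r
      ≈⟨ solve 3 (λ t l m → (t :+ l) :* m :- l :* m := t :* m) Ser.refl (T y) Λ₁ (M r) ⟩
    T y ⊛ M r
      ∎
    where
    r = ℕ→ℚ (suc y)
    T₁ = T (suc y)
    Λ₁ = Λ (suc y)
    Φ₁ = Φcoef (suc y)
    E = (cst r ⊖ U) ⊛ V
    Λ⊛M≈T₁⊛[E+W] : Λ₁ ⊛ M r ≈ₛ T₁ ⊛ (E ⊕ W)
    Λ⊛M≈T₁⊛[E+W] = begin
      Λ₁ ⊛ M r
        ≈⟨ Ser.*-congʳ {M r} (Λ-odd odd-1+y) ⟩
      (cst (recip r) ⊛ (T₁ ⊛ V) ⊕ Φ₁ ⊛ W) ⊛ M r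
        ≈⟨ solve 5 (λ i x φ w m → (i :* x :+ φ :* w) :* m := (i :* m) :* x :+ (φ :* m) :* w) Ser.refl
                   (cst (recip r)) (T₁ ⊛ V) Φ₁ W (M r) ⟩
      (cst (recip r) ⊛ M r) ⊛ (T₁ ⊛ V) ⊕ (Φ₁ ⊛ M r) ⊛ W
        ≈⟨ Ser.+-cong (Ser.*-congʳ {T₁ ⊛ V} (recip⊛M (ℕ→ℚ-≢0 (suc y))))
                      (Ser.*-congʳ {W} (Φ⊛M≈T odd-1+y)) ⟩
      (cst r ⊖ U) ⊛ (T₁ ⊛ V) ⊕ T₁ ⊛ W
        ≈⟨ solve 4 (λ ρ t v w → ρ :* (t :* v) :+ t :* w := t :* (ρ :* v :+ w)) Ser.refl (cst r ⊖ U) T₁ V W ⟩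
      T₁ ⊛ (E ⊕ W) ∎

  P Q : ℕ → Ser
  P zero    = cst 1ℚ
  P (suc n) = P n ⊛ N (ℕ→ℚ (suc (n ℕ.+ n)))
  Q zero    = cst 1ℚ
  Q (suc n) = Q n ⊛ M (ℕ→ℚ (suc (n ℕ.+ n)))

  T⊛P≈Q    : ∀ n → T (n ℕ.+ n) ⊛ P n ≈ₛ Q n
  T-odd⊛P≈Q : ∀ n → T (suc (n ℕ.+ n)) ⊛ P (suc n) ≈ₛ Q (suc n)

  T⊛P≈Q zero    = Ser.trans (Ser.*-identityʳ (T 0)) T-zero
  T⊛P≈Q (suc n) = begin
    T (suc n ℕ.+ suc n) ⊛ P (suc n)       ≈⟨ Ser.*-congʳ {P (suc n)} (Ser.reflexive (cong (T ∘ suc) (ℕ.+-suc n n))) ⟩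
    T (suc (suc (n ℕ.+ n))) ⊛ P (suc n)   ≈⟨ Ser.*-congʳ {P (suc n)} (T-step-even (odd-2n+2 n)) ⟩
    T (suc (n ℕ.+ n)) ⊛ P (suc n)         ≈⟨ T-odd⊛P≈Q n ⟩
    Q (suc n)                             ∎

  T-odd⊛P≈Q n = begin
    T (suc (n ℕ.+ n)) ⊛ (P n ⊛ N r)     ≈⟨ x∙yz≈xz∙y (T (suc (n ℕ.+ n))) (P n) (N r) ⟩
    (T (suc (n ℕ.+ n)) ⊛ N r) ⊛ P n     ≈⟨ Ser.*-congʳ {P n} (T-step-odd (odd-2n+1 n)) ⟩
    (T (n ℕ.+ n) ⊛ M r) ⊛ P n           ≈⟨ xy∙z≈xz∙y (T (n ℕ.+ n)) (M r) (P n) ⟩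
    (T (n ℕ.+ n) ⊛ P n) ⊛ M r           ≈⟨ Ser.*-congʳ {M r} (T⊛P≈Q n) ⟩
    Q n ⊛ M r                           ∎
    where
    open import Algebra.Properties.CommutativeSemigroup Ser.*-commutativeSemigroup using (x∙yz≈xz∙y; xy∙z≈xz∙y)
    r = ℕ→ℚ (suc (n ℕ.+ n))

  Φ⊛M⊛P≈Q : ∀ n → Φcoef (suc (n ℕ.+ n)) ⊛ (M (ℕ→ℚ (suc (n ℕ.+ n))) ⊛ P (suc n)) ≈ₛ Q (suc n)
  Φ⊛M⊛P≈Q n = begin
    Φ ⊛ (M r ⊛ P (suc n))          ≈⟨ Ser.*-assoc Φ (M r) (P (suc n)) ⟨
    (Φ ⊛ M r) ⊛ P (suc n)          ≈⟨ Ser.*-congʳ {P (suc n)} (Φ⊛M≈T (odd-2n+1 n)) ⟩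
    T (suc (n ℕ.+ n)) ⊛ P (suc n)  ≈⟨ T-odd⊛P≈Q n ⟩
    Q (suc n)                      ∎
    where
    r = ℕ→ℚ (suc (n ℕ.+ n))
    Φ = Φcoef (suc (n ℕ.+ n))

  odd-square≢0 : ∀ n → ℕ→ℚ (suc (n ℕ.+ n)) * ℕ→ℚ (suc (n ℕ.+ n)) ≢ 0ℚ
  odd-square≢0 n = *-≢0 (ℕ→ℚ-≢0 (suc (n ℕ.+ n))) (ℕ→ℚ-≢0 (suc (n ℕ.+ n)))

  P-origin≢0 : ∀ n → P n 0 0 0 ≢ 0ℚ
  P-origin≢0 zero    = ℚ.1≢0
  P-origin≢0 (suc n) PN≡0 =
    *-≢0 (P-origin≢0 n) (odd-square≢0 n ∘ trans (sym (N-origin (ℕ→ℚ (suc (n ℕ.+ n))))))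
         (trans (sym (⊛-origin (P n) (N (ℕ→ℚ (suc (n ℕ.+ n)))))) PN≡0)

  M⊛P-origin≢0 : ∀ n → (M (ℕ→ℚ (suc (n ℕ.+ n))) ⊛ P (suc n)) 0 0 0 ≢ 0ℚ
  M⊛P-origin≢0 n MP≡0 =
    *-≢0 (odd-square≢0 n ∘ trans (sym (M-origin (ℕ→ℚ (suc (n ℕ.+ n)))))) (P-origin≢0 (suc n))
         (trans (sym (⊛-origin (M (ℕ→ℚ (suc (n ℕ.+ n)))) (P (suc n)))) MP≡0)

module Hypergeometric where

  open import Data.Nat.Base as ℕ using (ℕ; zero; suc)
  import Data.Nat.Properties as ℕ
  open import Data.Rational.Base using (ℚ; 0ℚ; 1ℚ; _+_; _*_)
  import Data.Rational.Properties as ℚ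
  open import Relation.Binary.PropositionalEquality
  open import Defs
  open RationalFacts
  open Trivariate
  open GeneratingFunctions
  open Inverse
  open Products
  open SerSolver using (solve; _:=_; _:+_; _:*_; _:-_; con)
  open import Relation.Binary.Reasoning.Setoid Ser.setoid
  open import Algebra.Properties.CommutativeSemigroup Ser.*-commutativeSemigroup using (interchange)

  Mₛ-cong : ∀ {R R′} → R ≈ₛ R′ → Mₛ R ≈ₛ Mₛ R′
  Mₛ-cong R≈R′ = Ser.+-cong (Ser.*-cong R≈R′ R≈R′) (Ser.-‿cong (Ser.*-congʳ {U} R≈R′))

  Nₛ-cong : ∀ {R R′} → R ≈ₛ R′ → Nₛ R ≈ₛ Nₛ R′
  Nₛ-cong R≈R′ = Ser.+-cong (Ser.+-cong (Mₛ-cong R≈R′)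
    (Ser.-‿cong (Ser.*-congʳ {V} (Ser.+-congʳ {S₂.⊟ U} R≈R′)))) Ser.refl

  cst-k+2j : ∀ k j → cst (ℕ→ℚ (k ℕ.+ (j ℕ.+ j))) ≈ₛ cst (ℕ→ℚ k) ⊕ (cst (ℕ→ℚ j) ⊕ cst (ℕ→ℚ j))
  cst-k+2j k j = begin
    cst (ℕ→ℚ (k ℕ.+ (j ℕ.+ j)))
      ≈⟨ cst-cong (trans (ℕ→ℚ-+ k (j ℕ.+ j)) (cong (ℕ→ℚ k +_) (ℕ→ℚ-+ j j))) ⟩
    cst (ℕ→ℚ k + (ℕ→ℚ j + ℕ→ℚ j))
      ≈⟨ Ser.trans (cst-+ (ℕ→ℚ k) _) (Ser.+-congˡ {cst (ℕ→ℚ k)} (cst-+ (ℕ→ℚ j) (ℕ→ℚ j))) ⟩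
    cst (ℕ→ℚ k) ⊕ (cst (ℕ→ℚ j) ⊕ cst (ℕ→ℚ j))
      ∎

  pow4 : ℕ → ℚ
  pow4 zero    = 1ℚ
  pow4 (suc n) = pow4 n * ℕ→ℚ 4

  A : Ser
  A = cst ½ ⊖ cst ½ ⊛ U

  4[A+j][½+j]≈M : ∀ j → cst (ℕ→ℚ 4) ⊛ ((A ⊕ cst (ℕ→ℚ j)) ⊛ (cst ½ ⊕ cst (ℕ→ℚ j))) ≈ₛ M (ℕ→ℚ (suc (j ℕ.+ j)))
  4[A+j][½+j]≈M j = begin
    cst (ℕ→ℚ 4) ⊛ ((A ⊕ jₛ) ⊛ (cst ½ ⊕ jₛ))
      ≈⟨ solve 2 (λ jₛ u → con (ℕ→ℚ 4) :* (((con ½ :- con ½ :* u) :+ jₛ) :* (con ½ :+ jₛ))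
                        := (con 1ℚ :+ (jₛ :+ jₛ)) :* (con 1ℚ :+ (jₛ :+ jₛ)) :- (con 1ℚ :+ (jₛ :+ jₛ)) :* u) Ser.refl jₛ U ⟩
    Mₛ (cst 1ℚ ⊕ (jₛ ⊕ jₛ))              ≈⟨ Mₛ-cong (cst-k+2j 1 j) ⟨
    M (ℕ→ℚ (suc (j ℕ.+ j)))            ∎
    where jₛ = cst (ℕ→ℚ j)

  4[e₂+je₁+j²]≈N : ∀ j → cst (ℕ→ℚ 4) ⊛ (e₂ ⊕ cst (ℕ→ℚ j) ⊛ e₁ ⊕ cst (ℕ→ℚ (j ℕ.* j))) ≈ₛ N (ℕ→ℚ (3 ℕ.+ (j ℕ.+ j)))
  4[e₂+je₁+j²]≈N j = begin
    cst (ℕ→ℚ 4) ⊛ (e₂ ⊕ jₛ ⊛ e₁ ⊕ cst (ℕ→ℚ (j ℕ.* j)))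
      ≈⟨ Ser.*-congˡ {cst (ℕ→ℚ 4)} (Ser.+-congˡ {e₂ ⊕ jₛ ⊛ e₁} j²≈jₛ⊛jₛ) ⟩
    cst (ℕ→ℚ 4) ⊛ (e₂ ⊕ jₛ ⊛ e₁ ⊕ jₛ ⊛ jₛ)
      ≈⟨ solve 4 (λ jₛ u v w →
            con (ℕ→ℚ 4) :* (con ¼ :* (con (ℕ→ℚ 9) :- con (ℕ→ℚ 3) :* u :- con (ℕ→ℚ 3) :* v :+ u :* v :- w)
               :+ jₛ :* (con (ℕ→ℚ 3) :- con ½ :* u :- con ½ :* v) :+ jₛ :* jₛ)
            := ((con (ℕ→ℚ 3) :+ (jₛ :+ jₛ)) :* (con (ℕ→ℚ 3) :+ (jₛ :+ jₛ)) :- (con (ℕ→ℚ 3) :+ (jₛ :+ jₛ)) :* u)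
               :- ((con (ℕ→ℚ 3) :+ (jₛ :+ jₛ)) :- u) :* v :- w) Ser.refl jₛ U V W ⟩
    Nₛ (cst (ℕ→ℚ 3) ⊕ (jₛ ⊕ jₛ))
      ≈⟨ Nₛ-cong (cst-k+2j 3 j) ⟨
    N (ℕ→ℚ (3 ℕ.+ (j ℕ.+ j)))
      ∎
    where
    jₛ = cst (ℕ→ℚ j)
    j²≈jₛ⊛jₛ : cst (ℕ→ℚ (j ℕ.* j)) ≈ₛ jₛ ⊛ jₛ
    j²≈jₛ⊛jₛ = Ser.trans (cst-cong (ℕ→ℚ-* j j)) (Ser.sym (cst-* (ℕ→ℚ j) (ℕ→ℚ j)))

  4ⁿDαβ≈P : ∀ n → cst (pow4 n) ⊛ (D ⊛ pochαβ n) ≈ₛ P (suc n)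
  4ⁿDαβ≈P zero = solve 3 (λ u v w → con 1ℚ :* ((con 1ℚ :- u :- v :+ u :* v :- w) :* con 1ℚ)
                                 := con 1ℚ :* ((con 1ℚ :* con 1ℚ :- con 1ℚ :* u) :- (con 1ℚ :- u) :* v :- w)) Ser.refl U V W
  4ⁿDαβ≈P (suc n) = begin
    cst (pow4 n * ℕ→ℚ 4) ⊛ (D ⊛ (pochαβ n ⊛ step))
      ≈⟨ Ser.*-congʳ {D ⊛ (pochαβ n ⊛ step)} (cst-* (pow4 n) (ℕ→ℚ 4)) ⟨
    (cst (pow4 n) ⊛ cst (ℕ→ℚ 4)) ⊛ (D ⊛ (pochαβ n ⊛ step))
      ≈⟨ Ser.*-congˡ {cst (pow4 n) ⊛ cst (ℕ→ℚ 4)} (Ser.*-assoc D (pochαβ n) step) ⟨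
    (cst (pow4 n) ⊛ cst (ℕ→ℚ 4)) ⊛ ((D ⊛ pochαβ n) ⊛ step)
      ≈⟨ interchange (cst (pow4 n)) (cst (ℕ→ℚ 4)) (D ⊛ pochαβ n) step ⟩
    (cst (pow4 n) ⊛ (D ⊛ pochαβ n)) ⊛ (cst (ℕ→ℚ 4) ⊛ step)
      ≈⟨ Ser.*-cong (4ⁿDαβ≈P n) (4[e₂+je₁+j²]≈N n) ⟩
    P (suc n) ⊛ N (ℕ→ℚ (3 ℕ.+ (n ℕ.+ n)))
      ≈⟨ Ser.reflexive (cong (λ k → P (suc n) ⊛ N (ℕ→ℚ (suc (suc k)))) (ℕ.+-suc n n)) ⟨
    P (suc (suc n)) ∎
    where
    step = e₂ ⊕ cst (ℕ→ℚ n) ⊛ e₁ ⊕ cst (ℕ→ℚ (n ℕ.* n))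

  4ⁿA½≈Q : ∀ n → cst (pow4 n) ⊛ (pochₛ A n ⊛ cst (pochℚ ½ n)) ≈ₛ Q n
  4ⁿA½≈Q zero    = Ser.trans (Ser.*-identityˡ _) (Ser.*-identityˡ (cst 1ℚ))
  4ⁿA½≈Q (suc n) = begin
    cst (pow4 n * ℕ→ℚ 4) ⊛ ((pochₛ A n ⊛ (A ⊕ jₛ)) ⊛ cst (pochℚ ½ n * (½ + j)))
      ≈⟨ Ser.*-cong (Ser.sym (cst-* (pow4 n) (ℕ→ℚ 4)))
                    (Ser.*-congˡ {pochₛ A n ⊛ (A ⊕ jₛ)} (Ser.trans (Ser.sym (cst-* (pochℚ ½ n) (½ + j)))
                                                                     (Ser.*-congˡ {cst (pochℚ ½ n)} (cst-+ ½ j)))) ⟩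
    (cst (pow4 n) ⊛ cst (ℕ→ℚ 4)) ⊛ ((pochₛ A n ⊛ (A ⊕ jₛ)) ⊛ (cst (pochℚ ½ n) ⊛ (cst ½ ⊕ jₛ)))
      ≈⟨ Ser.*-congˡ {cst (pow4 n) ⊛ cst (ℕ→ℚ 4)}
                     (interchange (pochₛ A n) (A ⊕ jₛ) (cst (pochℚ ½ n)) (cst ½ ⊕ jₛ)) ⟩
    (cst (pow4 n) ⊛ cst (ℕ→ℚ 4)) ⊛ ((pochₛ A n ⊛ cst (pochℚ ½ n)) ⊛ ((A ⊕ jₛ) ⊛ (cst ½ ⊕ jₛ)))
      ≈⟨ interchange (cst (pow4 n)) (cst (ℕ→ℚ 4)) (pochₛ A n ⊛ cst (pochℚ ½ n)) ((A ⊕ jₛ) ⊛ (cst ½ ⊕ jₛ)) ⟩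
    (cst (pow4 n) ⊛ (pochₛ A n ⊛ cst (pochℚ ½ n))) ⊛ (cst (ℕ→ℚ 4) ⊛ ((A ⊕ jₛ) ⊛ (cst ½ ⊕ jₛ)))
      ≈⟨ Ser.*-cong (4ⁿA½≈Q n) (4[A+j][½+j]≈M n) ⟩
    Q n ⊛ M (ℕ→ℚ (suc (n ℕ.+ n))) ∎
    where
    j = ℕ→ℚ n
    jₛ = cst j

  pochαβ-origin≢0 : ∀ n → pochαβ n 0 0 0 ≢ 0ℚ
  pochαβ-origin≢0 n αβ₀≡0 = P-origin≢0 (suc n)
    (trans (sym (4ⁿDαβ≈P n 0 0 0))
           (⊛-origin-zeroʳ (cst (pow4 n)) {D ⊛ pochαβ n} (⊛-origin-zeroʳ D {pochαβ n} αβ₀≡0)))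

  hypergeometric⊛P≈Q : ∀ n → (invₛ D ⊛ F32term n) ⊛ P (suc n) ≈ₛ Q n
  hypergeometric⊛P≈Q n = begin
    (invₛ D ⊛ (Aₙκ ⊛ invₛ αβ)) ⊛ P (suc n)
      ≈⟨ Ser.*-congˡ {invₛ D ⊛ (Aₙκ ⊛ invₛ αβ)} (4ⁿDαβ≈P n) ⟨
    (invₛ D ⊛ (Aₙκ ⊛ invₛ αβ)) ⊛ (cst (pow4 n) ⊛ (D ⊛ αβ))
      ≈⟨ Ser.*-congʳ {cst (pow4 n) ⊛ (D ⊛ αβ)} (x∙yz≈y∙xz (invₛ D) Aₙκ (invₛ αβ)) ⟩
    (Aₙκ ⊛ (invₛ D ⊛ invₛ αβ)) ⊛ (cst (pow4 n) ⊛ (D ⊛ αβ))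
      ≈⟨ interchange Aₙκ (invₛ D ⊛ invₛ αβ) (cst (pow4 n)) (D ⊛ αβ) ⟩
    (Aₙκ ⊛ cst (pow4 n)) ⊛ ((invₛ D ⊛ invₛ αβ) ⊛ (D ⊛ αβ))
      ≈⟨ Ser.*-cong (Ser.*-comm Aₙκ (cst (pow4 n))) (interchange (invₛ D) (invₛ αβ) D αβ) ⟩
    (cst (pow4 n) ⊛ Aₙκ) ⊛ ((invₛ D ⊛ D) ⊛ (invₛ αβ ⊛ αβ))
      ≈⟨ Ser.*-congˡ {cst (pow4 n) ⊛ Aₙκ}
                     (Ser.*-cong (invₛ-inverseˡ D ℚ.1≢0) (invₛ-inverseˡ αβ (pochαβ-origin≢0 n))) ⟩
    (cst (pow4 n) ⊛ Aₙκ) ⊛ (cst 1ℚ ⊛ cst 1ℚ)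
      ≈⟨ Ser.trans (Ser.*-congˡ {cst (pow4 n) ⊛ Aₙκ} (Ser.*-identityˡ (cst 1ℚ))) (Ser.*-identityʳ _) ⟩
    cst (pow4 n) ⊛ Aₙκ
      ≈⟨ Ser.*-congˡ {cst (pow4 n)} (Ser.*-congˡ {pochₛ A n} (cst-cong (F32-coefficient n))) ⟩
    cst (pow4 n) ⊛ (pochₛ A n ⊛ cst (pochℚ ½ n))
      ≈⟨ 4ⁿA½≈Q n ⟩
    Q n ∎
    where
    open import Algebra.Properties.CommutativeSemigroup Ser.*-commutativeSemigroup using (x∙yz≈y∙xz)
    αβ = pochαβ n
    Aₙκ = pochₛ A n ⊛ cst (pochℚ ½ n * pochℚ 1ℚ n * recip (ℕ→ℚ (fact n)))

  Φcoef≈hypergeometric : ∀ n → Φcoef (suc (n ℕ.+ n)) ≈ₛ invₛ D ⊛ F32term n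
  Φcoef≈hypergeometric n = ⊛-cancelʳ _ _ (M r ⊛ P (suc n)) (M⊛P-origin≢0 n) (begin
    Φcoef (suc (n ℕ.+ n)) ⊛ (M r ⊛ P (suc n))   ≈⟨ Φ⊛M⊛P≈Q n ⟩
    Q n ⊛ M r                                   ≈⟨ Ser.*-congʳ {M r} (hypergeometric⊛P≈Q n) ⟨
    (invₛ D ⊛ F32term n ⊛ P (suc n)) ⊛ M r      ≈⟨ xy∙z≈x∙zy (invₛ D ⊛ F32term n) (P (suc n)) (M r) ⟩
    (invₛ D ⊛ F32term n) ⊛ (M r ⊛ P (suc n))    ∎)
    where
    open import Algebra.Properties.CommutativeSemigroup Ser.*-commutativeSemigroup using (xy∙z≈x∙zy)
    r = ℕ→ℚ (suc (n ℕ.+ n))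

open import Data.Bool.Base using (true; false; if_then_else_)
open import Data.Nat.Base using (ℕ; _/_)
open import Data.Rational.Base using (0ℚ)
open import Relation.Binary.PropositionalEquality
open Parity
open Indices
open Hypergeometric

-- The parity is passed as an equation: abstracting odd m with a with-clause would make Agda
-- normalise Φcoef m a b c.
Φcoef-by-parity : ∀ m a b c {o} → odd m ≡ o →
                  Φcoef m a b c ≡ (if o then (invₛ D ⊛ F32term (m / 2)) a b c else 0ℚ)
Φcoef-by-parity m a b c {true}  odd-m  =
  trans (cong (λ k → Φcoef k a b c) (odd⇒≡2n+1 odd-m)) (Φcoef≈hypergeometric (m / 2) a b c)
Φcoef-by-parity m a b c {false} even-m = Φcoef-even even-m a b c

theorem3p4 : (m a b c : ℕ) → Φcoef m a b c ≡ RHScoef m a b c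
theorem3p4 m a b c = Φcoef-by-parity m a b c refl
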